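{- Let $G(V,E)$ be a graph without loops and multiple edges, with edges numbered $e_1,\dots,e_n$. Then for every sufficiently large prime $p$ and every natural number $k\ge 1$, the value $\chi_{MA(G)}(p^k)$ of the characteristic polynomial of the matching arrangement of $G$ equals the number of proper weight functions $W:E\to F_p^k$.
   Context: The matching arrangement $MA(G)$ is the arrangement of hyperplanes in $\mathbb{R}^n$ containing, for every sequence of edges $(e_{i_1},\dots,e_{i_k})$ (listed in order along the path/cycle) that forms either a simple path of arbitrary length $k\ge 1$ or a simple cycle of even length in $G$, the hyperplane $x_{i_1}-x_{i_2}+\dots+(-1)^{k+1}x_{i_k}=0$. For a hyperplane arrangement $A$ in $\mathbb{R}^n$, $L(A)$ is the poset of $\mathbb{R}^n$ and all nonempty intersections of hyperplanes of $A$, ordered by reverse inclusion, with minimal element $\hat 0=\mathbb{R}^n$; with Möbius function $\mu$ of this poset ($\mu(x,x)=1$, $\mu(x,y)=-\sum_{x\le z<y}\mu(x,z)$ for $x<y$), the characteristic polynomial is $\chi_A(t)=\sum_{x\in L(A)}\mu(\hat 0,x)\,t^{\dim x}$. $F_p$ is the field of residues modulo $p$. A weight function $W:E\to F_p^k$ is improper if there is a sequence of edges $(e_{i_1},\dots,e_{i_d})$ forming a simple path or a simple even cycle in $G$ with $W(e_{i_1})-W(e_{i_2})+\dots+(-1)^{d-1}W(e_{i_d})=\mathbf{0}\in F_p^k$; otherwise $W$ is proper. -}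

module Defs where

open import Function using (_∘_)
open import Data.Nat as ℕ using (ℕ; zero; suc; _∸_; _<ᵇ_; _≡ᵇ_; _⊔_; _≤ᵇ_)
open import Data.Nat.Divisibility using (_∣?_)
open import Data.Integer as ℤ using (ℤ; +_; 0ℤ; 1ℤ; -1ℤ; -_; _-_; _+_; _*_; ∣_∣; _^_)
open import Data.Fin as Fin using (Fin; toℕ)
open import Data.Fin.Properties using () renaming (_≟_ to _≟ᶠ_)
open import Data.Bool using (Bool; true; false; _∧_; _∨_; not; if_then_else_)
open import Data.Bool.ListAction using (any; all)
open import Data.List using (List; []; _∷_; _++_; map; length; filterᵇ; concatMap; allFin; foldr; upTo; zipWith; lookup)
open import Data.Product using (_×_; _,_; proj₁; proj₂)
open import Data.Sum using (_⊎_)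
open import Data.Vec as Vec using (Vec)
open import Relation.Nullary.Decidable using (⌊_⌋)
open import Relation.Binary.PropositionalEquality using (_≡_; _≢_)

-- Graphs: vertices Fin V, edges e_0 … e_{n-1}, edge i has endpoints ends i.

SameEnds : ∀ {V} → Fin V × Fin V → Fin V × Fin V → Set
SameEnds (a , b) (c , d) = (a ≡ c × b ≡ d) ⊎ (a ≡ d × b ≡ c)

SimpleGraph : ∀ {V n} → (Fin n → Fin V × Fin V) → Set
SimpleGraph {V} {n} ends =
  (∀ i → proj₁ (ends i) ≢ proj₂ (ends i)) ×
  (∀ i j → SameEnds (ends i) (ends j) → i ≡ j)

eqF : ∀ {m} → Fin m → Fin m → Bool
eqF a b = ⌊ a ≟ᶠ b ⌋

memb : ∀ {m} → Fin m → List (Fin m) → Bool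
memb x xs = any (eqF x) xs

distinct? : ∀ {m} → List (Fin m) → Bool
distinct? [] = true
distinct? (x ∷ xs) = not (memb x xs) ∧ distinct? xs

listsOfLength : ∀ {A : Set} → ℕ → List A → List (List A)
listsOfLength zero xs = [] ∷ []
listsOfLength (suc ℓ) xs = concatMap (λ x → map (x ∷_) (listsOfLength ℓ xs)) xs

allVecs : ∀ {A : Set} → (ℓ : ℕ) → List A → List (Vec A ℓ)
allVecs zero xs = Vec.[] ∷ []
allVecs (suc ℓ) xs = concatMap (λ x → map (x Vec.∷_) (allVecs ℓ xs)) xs

sublists : ∀ {A : Set} → List A → List (List A)
sublists [] = [] ∷ []
sublists (x ∷ xs) = sublists xs ++ map (x ∷_) (sublists xs)

evenᵇ : ℕ → Bool
evenᵇ zero = true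
evenᵇ (suc k) = not (evenᵇ k)

sumℤ : List ℤ → ℤ
sumℤ = foldr _+_ 0ℤ

maxℕ : List ℕ → ℕ
maxℕ = foldr _⊔_ 0

-- Linear algebra over ℤ ⊆ ℚ ⊆ ℝ: determinant (Laplace expansion along
-- the first row) and rank as the largest size of a nonvanishing minor.

dropAt : ∀ {A : Set} → ℕ → List A → List A
dropAt _ [] = []
dropAt zero (x ∷ xs) = xs
dropAt (suc j) (x ∷ xs) = x ∷ dropAt j xs

detN : ℕ → List (List ℤ) → ℤ
detN zero _ = 1ℤ
detN (suc s) [] = 1ℤ
detN (suc s) (r ∷ rs) =
  sumℤ (zipWith (λ j a → (if evenᵇ j then 1ℤ else -1ℤ) * a * detN s (map (dropAt j) rs))
                (upTo (length r)) r)

det : List (List ℤ) → ℤ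
det M = detN (length M) M

nonzeroℤ : ℤ → Bool
nonzeroℤ z = not ⌊ z ℤ.≟ 0ℤ ⌋

rank : (n : ℕ) → List (Fin n → ℤ) → ℕ
rank n M =
  maxℕ (concatMap
         (λ R → map (λ C → if (length R ≡ᵇ length C) ∧ nonzeroℤ (det (map (λ v → map v C) R))
                            then length R else 0)
                    (sublists (allFin n)))
         (sublists M))

-- Intersection poset and characteristic polynomial of a central
-- arrangement in ℝ^n whose hyperplanes are {x | Σ_j a_j x_j = 0}, given by
-- their integer normal vectors a.  An element X of L(A) is represented by
-- the (unique) closed set of hyperplanes containing it: S is closed iff
-- every hyperplane H with ∩S ⊆ H (i.e. rank(S ∪ {H}) = rank S) is in S.
-- Reverse inclusion of subspaces = inclusion of closed sets; dim ∩S = n - rank S.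

module Arrangement (n : ℕ) (H : List (Fin n → ℤ)) where

  m : ℕ
  m = length H

  hyp : Fin m → Fin n → ℤ
  hyp = lookup H

  rk : List (Fin m) → ℕ
  rk S = rank n (map hyp S)

  dim : List (Fin m) → ℕ
  dim S = n ∸ rk S

  contains : List (Fin m) → Fin m → Bool
  contains S h = rk (h ∷ S) ≡ᵇ rk S

  closedᵇ : List (Fin m) → Bool
  closedᵇ S = all (λ h → not (contains S h) ∨ memb h S) (allFin m)

  flats : List (List (Fin m))
  flats = filterᵇ closedᵇ (sublists (allFin m))

  ⊆ᵇ : List (Fin m) → List (Fin m) → Bool
  ⊆ᵇ S T = all (λ x → memb x T) S

  leᵇ : List (Fin m) → List (Fin m) → Bool
  leᵇ = ⊆ᵇ

  ltᵇ : List (Fin m) → List (Fin m) → Bool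
  ltᵇ S T = ⊆ᵇ S T ∧ not (⊆ᵇ T S)

  -- 0̂ = ℝ^n, the intersection of the empty set of hyperplanes
  bottom : List (Fin m)
  bottom = filterᵇ (contains []) (allFin m)

  isBottom : List (Fin m) → Bool
  isBottom S = ⊆ᵇ S bottom ∧ ⊆ᵇ bottom S

  -- μ(0̂, y), by the recursion μ(0̂,0̂)=1, μ(0̂,y) = - Σ_{0̂ ≤ z < y} μ(0̂,z);
  -- fuel suc m suffices since strict chains of closed sets have length ≤ m
  muFuel : ℕ → List (Fin m) → ℤ
  muFuel zero y = 0ℤ
  muFuel (suc f) y =
    if isBottom y then 1ℤ
    else - sumℤ (map (muFuel f) (filterᵇ (λ z → leᵇ bottom z ∧ ltᵇ z y) flats))

  μ₀ : List (Fin m) → ℤ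
  μ₀ = muFuel (suc m)

  charPoly : ℤ → ℤ
  charPoly t = sumℤ (map (λ x → μ₀ x * (t ^ dim x)) flats)

module Matching {V n : ℕ} (ends : Fin n → Fin V × Fin V) where

  joins? : Fin V × Fin V → Fin V → Fin V → Bool
  joins? (a , b) u w = (eqF a u ∧ eqF b w) ∨ (eqF a w ∧ eqF b u)

  walk? : List (Fin n) → List (Fin V) → Bool
  walk? [] (v ∷ []) = true
  walk? (e ∷ es) (u ∷ w ∷ vs) = joins? (ends e) u w ∧ walk? es (w ∷ vs)
  walk? _ _ = false

  lastIs : Fin V → List (Fin V) → Bool
  lastIs v [] = false
  lastIs v (x ∷ []) = eqF v x
  lastIs v (x ∷ y ∷ r) = lastIs v (y ∷ r)

  closes? : List (Fin V) → Bool
  closes? [] = false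
  closes? (v ∷ rest) = distinct? rest ∧ lastIs v rest

  simplePath? : List (Fin n) → Bool
  simplePath? es =
    (1 ≤ᵇ length es) ∧
    any (λ vs → distinct? vs ∧ walk? es vs) (listsOfLength (suc (length es)) (allFin V))

  evenCycle? : List (Fin n) → Bool
  evenCycle? es =
    evenᵇ (length es) ∧ (3 ≤ᵇ length es) ∧
    any (λ vs → closes? vs ∧ walk? es vs) (listsOfLength (suc (length es)) (allFin V))

  valid? : List (Fin n) → Bool
  valid? es = simplePath? es ∨ evenCycle? es

  -- all edge sequences forming a simple path or a simple even cycle
  -- (such sequences use distinct edges, hence have length ≤ n)
  validSeqs : List (List (Fin n))
  validSeqs = filterᵇ valid? (concatMap (λ ℓ → listsOfLength ℓ (allFin n)) (upTo (suc n)))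

  -- normal vector of x_{i_1} - x_{i_2} + … + (-1)^{k+1} x_{i_k} = 0
  altVec : List (Fin n) → Fin n → ℤ
  altVec [] j = 0ℤ
  altVec (i ∷ is) j = (if eqF i j then 1ℤ else 0ℤ) - altVec is j

  MA : List (Fin n → ℤ)
  MA = map altVec validSeqs

  χMA : ℤ → ℤ
  χMA = Arrangement.charPoly n MA

  -- weight functions W : E → F_p^k, with F_p = Fin p (residues mod p)
  Weight : ℕ → ℕ → Set
  Weight p k = Vec (Vec (Fin p) k) n

  -- W(e_{i_1}) - W(e_{i_2}) + … computed in ℤ^k (reduce mod p afterwards)
  altW : ∀ {p k} → Weight p k → List (Fin n) → Fin k → ℤ
  altW W [] j = 0ℤ
  altW W (i ∷ is) j = + toℕ (Vec.lookup (Vec.lookup W i) j) - altW W is j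

  zeroMod : ∀ {k} → ℕ → (Fin k → ℤ) → Bool
  zeroMod {k} p v = all (λ j → ⌊ p ∣? ∣ v j ∣ ⌋) (allFin k)

  improper? : ∀ {p k} → Weight p k → Bool
  improper? {p} W = any (λ es → zeroMod p (altW W es)) validSeqs

  numProper : ℕ → ℕ → ℕ
  numProper p k = length (filterᵇ (not ∘ improper?) (allVecs n (allVecs k (allFin p))))

{-# OPTIONS --safe #-}
-- Let the hyperplanes have nonzero integer normal vectors and let p be a prime
-- exceeding the absolute value of every minor of them.  For a flat X of rank r fix
-- a nonzero r × r minor of its normals: Cramer's rule together with the inverse of
-- that minor mod p makes W ↦ (v · W)_v, v running over the r chosen normals, map
-- (F_p^k)^n onto (F_p^k)^r, and the vanishing bordered minors make every other normal
-- of X a combination of the chosen ones mod p.  Hence (p^k)^(n - r) points lie on all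
-- hyperplanes of X.  The hyperplanes through a point form a flat, so Möbius inversion
-- over the flats turns χ(p^k) = Σ_X μ(0̂, X) (p^k)^(dim X) into the number of points on
-- no hyperplane.  The matching arrangement qualifies: the normal of a path has
-- coefficient 1 at its first edge, that of a cycle coefficient -1 at its second.
module Submission where

open import Defs
open import Data.Nat using (ℕ; _≤_; _^_)
open import Data.Nat.Primality using (Prime)
open import Data.Integer using (+_)
open import Data.Fin using (Fin)
open import Data.Product using (_×_; ∃-syntax)
open import Relation.Binary.PropositionalEquality using (_≡_)

open import Data.Nat using (NonZero)
open import Data.Nat.Primality using (prime⇒nonZero)
open import Data.Integer using (ℤ)
open import Data.List using (List; length; allFin)
open import Data.Bool using (not)
open import Data.Product using (_,_)
open import Relation.Binary.PropositionalEquality using (cong; trans; sym)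

module Booleans where

  open import Function using (_∘_)
  open import Data.Fin as Fin using (Fin)
  import Data.Fin.Properties as Fin
  open import Data.List using (List; []; _∷_; map; filterᵇ; null)
  import Data.List.Properties as List
  open import Data.List.Membership.Propositional using (_∈_)
  import Data.List.Relation.Unary.Any as Any
  open import Data.List.Relation.Unary.Any.Properties using (any⁺; any⁻)
  import Data.List.Relation.Unary.All as All
  import Data.List.Relation.Unary.All.Properties as All
  open import Data.Bool using (Bool; true; false; T; not; _∨_; if_then_else_)
  open import Data.Bool.ListAction using (all; any; and; or)
  open import Data.Empty using (⊥-elim)
  open import Relation.Nullary using (¬_; yes; no)
  open import Relation.Nullary.Decidable using (toWitness; fromWitness)
  open import Relation.Binary.PropositionalEquality
  open import Defs using (eqF; memb)

  private
    variable
      A : Set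

  T⇔⇒≡ : ∀ {a b} → (T a → T b) → (T b → T a) → a ≡ b
  T⇔⇒≡ {false} {false} _ _ = refl
  T⇔⇒≡ {false} {true} _ b⇒a = ⊥-elim (b⇒a _)
  T⇔⇒≡ {true} {false} a⇒b _ = ⊥-elim (a⇒b _)
  T⇔⇒≡ {true} {true} _ _ = refl

  T-all⁺ : ∀ (P : A → Bool) xs → (∀ {x} → x ∈ xs → T (P x)) → T (all P xs)
  T-all⁺ P xs h = All.all⁻ P (All.tabulate h)

  T-all⁻ : ∀ (P : A → Bool) xs → T (all P xs) → ∀ {x} → x ∈ xs → T (P x)
  T-all⁻ P xs t = All.lookup (All.all⁺ P xs t)

  all-cong : ∀ {P Q : A → Bool} xs → (∀ x → P x ≡ Q x) → all P xs ≡ all Q xs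
  all-cong xs e = cong and (List.map-cong e xs)

  any-cong : ∀ {P Q : A → Bool} xs → (∀ x → P x ≡ Q x) → any P xs ≡ any Q xs
  any-cong xs e = cong or (List.map-cong e xs)

  eqF-suc : ∀ {n} (x y : Fin n) → eqF (Fin.suc x) (Fin.suc y) ≡ eqF x y
  eqF-suc x y with x Fin.≟ y
  ... | yes _ = refl
  ... | no _ = refl

  eqF⁻ : ∀ {n} (x y : Fin n) → T (eqF x y) → x ≡ y
  eqF⁻ x y = toWitness

  eqF-refl : ∀ {n} (x : Fin n) → eqF x x ≡ true
  eqF-refl x with x Fin.≟ x
  ... | yes _ = refl
  ... | no x≢x = ⊥-elim (x≢x refl)

  eqF-≢ : ∀ {n} {x y : Fin n} → x ≢ y → eqF x y ≡ false
  eqF-≢ {x = x} {y} x≢y with x Fin.≟ y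
  ... | yes x≡y = ⊥-elim (x≢y x≡y)
  ... | no _ = refl

  T-memb⁻ : ∀ {n} {x : Fin n} xs → T (memb x xs) → x ∈ xs
  T-memb⁻ xs t = Any.map toWitness (any⁻ _ xs t)

  T-memb⁺ : ∀ {n} {x : Fin n} xs → x ∈ xs → T (memb x xs)
  T-memb⁺ xs x∈ = any⁺ _ (Any.map fromWitness x∈)

  T-not⇒¬T : ∀ {b} → T (not b) → ¬ T b
  T-not⇒¬T {false} _ ()

  if-T : ∀ {b} {x y : A} → T b → (if b then x else y) ≡ x
  if-T {b = true} _ = refl

  T-not-∨ : ∀ {a b} → (T a → T b) → T (not a ∨ b)
  T-not-∨ {false} _ = _
  T-not-∨ {true} a⇒b = a⇒b _

  all-map : ∀ {B : Set} (P : B → Bool) (f : A → B) xs → all P (map f xs) ≡ all (P ∘ f) xs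
  all-map P f xs = cong and (sym (List.map-∘ xs))

  any-map : ∀ {B : Set} (P : B → Bool) (f : A → B) xs → any P (map f xs) ≡ any (P ∘ f) xs
  any-map P f xs = cong or (sym (List.map-∘ xs))

  null-filterᵇ : ∀ (P : A → Bool) xs → null (filterᵇ P xs) ≡ not (any P xs)
  null-filterᵇ P [] = refl
  null-filterᵇ P (x ∷ xs) with P x
  ... | true = refl
  ... | false = null-filterᵇ P xs

  filterᵇ-cong : ∀ {P Q : A → Bool} xs → (∀ x → P x ≡ Q x) → filterᵇ P xs ≡ filterᵇ Q xs
  filterᵇ-cong [] _ = refl
  filterᵇ-cong {Q = Q} (x ∷ xs) P≡Q rewrite P≡Q x with Q x
  ... | true = cong (x ∷_) (filterᵇ-cong xs P≡Q)
  ... | false = filterᵇ-cong xs P≡Q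

module Sums where

  open import Function using (_∘_)
  open import Data.Nat as ℕ using (ℕ; _<_; z≤n; s≤s)
  open import Data.Integer using (ℤ; 0ℤ; 1ℤ; -1ℤ; -_; _-_; _+_; _*_)
  import Data.Integer.Properties as ℤ
  open import Data.Integer.Tactic.RingSolver using (solve-∀)
  open import Data.List using (List; []; _∷_; length; map; filterᵇ; allFin; tabulate)
  import Data.List.Properties as List
  open import Data.List.Membership.Propositional using (_∈_)
  open import Data.List.Relation.Unary.Any using (here; there)
  import Data.List.Relation.Unary.All.Properties as All
  open import Data.List.Relation.Unary.AllPairs using (_∷_)
  open import Data.List.Relation.Unary.Unique.Propositional using (Unique)
  open import Data.Fin using (Fin; zero; suc)
  open import Data.Bool using (true; false; if_then_else_)
  open import Relation.Binary.PropositionalEquality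
  open import Defs using (sumℤ; eqF)
  open Booleans using (eqF-suc)

  private
    variable
      A B : Set

  -- isum f [x₀, x₁, …] = f 0 x₀ + f 1 x₁ + …: the summand also sees the position,
  -- which carries the signs of a Laplace expansion.
  isum : (ℕ → A → ℤ) → List A → ℤ
  isum f [] = 0ℤ
  isum f (x ∷ xs) = f 0 x + isum (f ∘ ℕ.suc) xs

  sumBy : (A → ℤ) → List A → ℤ
  sumBy f = isum (λ _ → f)

  isum-cong-∈ : ∀ {f g : ℕ → A → ℤ} xs → (∀ j x → x ∈ xs → f j x ≡ g j x) → isum f xs ≡ isum g xs
  isum-cong-∈ [] e = refl
  isum-cong-∈ (x ∷ xs) e = cong₂ _+_ (e 0 x (here refl)) (isum-cong-∈ xs (λ j y y∈ → e (ℕ.suc j) y (there y∈)))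

  isum-cong : ∀ {f g : ℕ → A → ℤ} xs → (∀ j x → f j x ≡ g j x) → isum f xs ≡ isum g xs
  isum-cong xs e = isum-cong-∈ xs (λ j x _ → e j x)

  isum-cong-< : ∀ {f g : ℕ → A → ℤ} xs → (∀ j x → j < length xs → f j x ≡ g j x) → isum f xs ≡ isum g xs
  isum-cong-< [] e = refl
  isum-cong-< (x ∷ xs) e = cong₂ _+_ (e 0 x (s≤s z≤n)) (isum-cong-< xs (λ j y j< → e (ℕ.suc j) y (s≤s j<)))

  isum-+ : ∀ (f g : ℕ → A → ℤ) xs → isum (λ j x → f j x + g j x) xs ≡ isum f xs + isum g xs
  isum-+ f g [] = refl
  isum-+ f g (x ∷ xs) =
    trans (cong (_+_ (f 0 x + g 0 x)) (isum-+ (f ∘ ℕ.suc) (g ∘ ℕ.suc) xs)) (interchange (f 0 x) (g 0 x) _ _)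
    where
    interchange : ∀ a b c d → a + b + (c + d) ≡ a + c + (b + d)
    interchange = solve-∀

  isum-*ˡ : ∀ c (f : ℕ → A → ℤ) xs → isum (λ j x → c * f j x) xs ≡ c * isum f xs
  isum-*ˡ c f [] = sym (ℤ.*-zeroʳ c)
  isum-*ˡ c f (x ∷ xs) = trans (cong (_+_ (c * f 0 x)) (isum-*ˡ c (f ∘ ℕ.suc) xs)) (sym (ℤ.*-distribˡ-+ c (f 0 x) _))

  isum-*ʳ : ∀ c (f : ℕ → A → ℤ) xs → isum (λ j x → f j x * c) xs ≡ isum f xs * c
  isum-*ʳ c f xs = begin
    isum (λ j x → f j x * c) xs ≡⟨ isum-cong xs (λ j x → ℤ.*-comm (f j x) c) ⟩
    isum (λ j x → c * f j x) xs ≡⟨ isum-*ˡ c f xs ⟩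
    c * isum f xs               ≡⟨ ℤ.*-comm c _ ⟩
    isum f xs * c               ∎
    where open ≡-Reasoning

  isum-neg : ∀ (f : ℕ → A → ℤ) xs → isum (λ j x → - f j x) xs ≡ - isum f xs
  isum-neg f xs = begin
    isum (λ j x → - f j x) xs    ≡⟨ isum-cong xs (λ j x → sym (ℤ.-1*i≡-i (f j x))) ⟩
    isum (λ j x → -1ℤ * f j x) xs ≡⟨ isum-*ˡ -1ℤ f xs ⟩
    -1ℤ * isum f xs              ≡⟨ ℤ.-1*i≡-i _ ⟩
    - isum f xs                  ∎
    where open ≡-Reasoning

  isum-zero : ∀ (xs : List A) → isum (λ _ _ → 0ℤ) xs ≡ 0ℤ
  isum-zero [] = refl
  isum-zero (x ∷ xs) = trans (ℤ.+-identityˡ _) (isum-zero xs)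

  isum-swap : ∀ (h : ℕ → A → ℕ → B → ℤ) xs ys →
    isum (λ j x → isum (h j x) ys) xs ≡ isum (λ i y → isum (λ j x → h j x i y) xs) ys
  isum-swap h [] ys = sym (isum-zero ys)
  isum-swap h (x ∷ xs) ys = begin
    isum (h 0 x) ys + isum (λ j x → isum (h (ℕ.suc j) x) ys) xs
      ≡⟨ cong (_+_ (isum (h 0 x) ys)) (isum-swap (h ∘ ℕ.suc) xs ys) ⟩
    isum (h 0 x) ys + isum (λ i y → isum (λ j x → h (ℕ.suc j) x i y) xs) ys
      ≡⟨ isum-+ (h 0 x) _ ys ⟨
    isum (λ i y → h 0 x i y + isum (λ j x → h (ℕ.suc j) x i y) xs) ys
      ∎
    where open ≡-Reasoning

  isum-map : ∀ (f : ℕ → B → ℤ) (g : A → B) xs → isum f (map g xs) ≡ isum (λ j → f j ∘ g) xs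
  isum-map f g [] = refl
  isum-map f g (x ∷ xs) = cong (_+_ (f 0 (g x))) (isum-map (f ∘ ℕ.suc) g xs)

  sumBy-filterᵇ : ∀ P (f : A → ℤ) xs → sumBy f (filterᵇ P xs) ≡ sumBy (λ x → if P x then f x else 0ℤ) xs
  sumBy-filterᵇ P f [] = refl
  sumBy-filterᵇ P f (x ∷ xs) with P x
  ... | true = cong (_+_ (f x)) (sumBy-filterᵇ P f xs)
  ... | false = trans (sumBy-filterᵇ P f xs) (sym (ℤ.+-identityˡ _))

  sumℤ-map : ∀ (f : A → ℤ) xs → sumℤ (map f xs) ≡ sumBy f xs
  sumℤ-map f [] = refl
  sumℤ-map f (x ∷ xs) = cong (_+_ (f x)) (sumℤ-map f xs)

  sumBy-zero-∈ : ∀ {f : A → ℤ} xs → (∀ {x} → x ∈ xs → f x ≡ 0ℤ) → sumBy f xs ≡ 0ℤ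
  sumBy-zero-∈ xs f≡0 = trans (isum-cong-∈ xs (λ _ _ x∈ → f≡0 x∈)) (isum-zero xs)

  sumBy-single : ∀ {f : A → ℤ} {y} xs → Unique xs → y ∈ xs →
    (∀ {x} → x ∈ xs → x ≢ y → f x ≡ 0ℤ) → sumBy f xs ≡ f y
  sumBy-single {f = f} (x ∷ xs) (x∉xs ∷ u) (here refl) f≡0 =
    trans (cong (_+_ (f x)) (sumBy-zero-∈ xs (λ x′∈ → f≡0 (there x′∈) (λ { refl → All.All¬⇒¬Any x∉xs x′∈ }))))
          (ℤ.+-identityʳ _)
  sumBy-single {f = f} (x ∷ xs) (x∉xs ∷ u) (there y∈) f≡0 =
    trans (cong (_+ sumBy f xs) (f≡0 (here refl) (λ { refl → All.All¬⇒¬Any x∉xs y∈ })))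
          (trans (ℤ.+-identityˡ _) (sumBy-single xs u y∈ (λ x′∈ → f≡0 (there x′∈))))

  sumBy-allFin-suc : ∀ {n} (f : Fin (ℕ.suc n) → ℤ) → sumBy f (allFin (ℕ.suc n)) ≡ f zero + sumBy (f ∘ suc) (allFin n)
  sumBy-allFin-suc {n} f = cong (_+_ (f zero)) (begin
    sumBy f (tabulate suc)          ≡⟨ cong (sumBy f) (List.map-tabulate (λ c → c) suc) ⟨
    sumBy f (map suc (allFin n))    ≡⟨ isum-map (λ _ → f) suc (allFin n) ⟩
    sumBy (f ∘ suc) (allFin n)      ∎)
    where open ≡-Reasoning

  δ : ∀ {n} → Fin n → Fin n → ℤ
  δ c c′ = if eqF c c′ then 1ℤ else 0ℤ

  δ-suc : ∀ {n} (c c′ : Fin n) → δ (suc c) (suc c′) ≡ δ c c′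
  δ-suc c c′ = cong (λ b → if b then 1ℤ else 0ℤ) (eqF-suc c c′)

  dot : ∀ {n} → (Fin n → ℤ) → (Fin n → ℤ) → ℤ
  dot v w = sumBy (λ c → v c * w c) (allFin _)

  dot-comm : ∀ {n} (v w : Fin n → ℤ) → dot v w ≡ dot w v
  dot-comm {n} v w = isum-cong (allFin n) (λ _ c → ℤ.*-comm (v c) (w c))

  dot-zeroˡ : ∀ {n} (w : Fin n → ℤ) → dot (λ _ → 0ℤ) w ≡ 0ℤ
  dot-zeroˡ {n} w = trans (isum-cong (allFin n) (λ _ c → ℤ.*-zeroˡ (w c))) (isum-zero (allFin n))

  dot-δʳ : ∀ {n} (v : Fin n → ℤ) c → dot v (δ c) ≡ v c
  dot-δʳ {ℕ.suc n} v c = trans (sumBy-allFin-suc (λ c′ → v c′ * δ c c′)) (split c)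
    where
    split : ∀ c → v zero * δ c zero + dot (v ∘ suc) (δ c ∘ suc) ≡ v c
    split zero = trans (cong₂ _+_ (ℤ.*-identityʳ (v zero))
      (trans (isum-cong (allFin n) (λ _ c′ → ℤ.*-zeroʳ (v (suc c′)))) (isum-zero (allFin n)))) (ℤ.+-identityʳ _)
    split (suc c) = trans (cong₂ _+_ (ℤ.*-zeroʳ (v zero))
      (trans (isum-cong (allFin n) (λ _ c′ → cong (v (suc c′) *_) (δ-suc c c′))) (dot-δʳ (v ∘ suc) c))) (ℤ.+-identityˡ _)

  dot-+ʳ : ∀ {n} (v a b : Fin n → ℤ) → dot v (λ c → a c + b c) ≡ dot v a + dot v b
  dot-+ʳ {n} v a b = trans (isum-cong (allFin n) (λ _ c → ℤ.*-distribˡ-+ (v c) (a c) (b c))) (isum-+ _ _ (allFin n))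

  dot-*ʳ : ∀ {n} (v a : Fin n → ℤ) e → dot v (λ c → e * a c) ≡ e * dot v a
  dot-*ʳ {n} v a e = trans (isum-cong (allFin n) (λ _ c → commute (v c) e (a c))) (isum-*ˡ e _ (allFin n))
    where
    commute : ∀ x y z → x * (y * z) ≡ y * (x * z)
    commute = solve-∀

  dot-negʳ : ∀ {n} (v a : Fin n → ℤ) → dot v (λ c → - a c) ≡ - dot v a
  dot-negʳ {n} v a = trans (isum-cong (allFin n) (λ _ c → sym (ℤ.neg-distribʳ-* (v c) (a c)))) (isum-neg _ (allFin n))

module Determinant where

  open import Function using (_∘_; flip)
  open import Data.Nat as ℕ using (ℕ; zero; suc; _<_; _≤_; z≤n; s≤s; _^_)
  import Data.Nat.Properties as ℕ
  open import Data.Integer using (ℤ; +_; 0ℤ; 1ℤ; -1ℤ; -_; _-_; _+_; _*_; ∣_∣)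
  import Data.Integer.Properties as ℤ
  open import Data.Integer.Tactic.RingSolver using (solve-∀)
  open import Data.List using (List; []; _∷_; length; map; zipWith; applyUpTo)
  import Data.List.Properties as List
  open import Data.List.Membership.Propositional using (_∈_)
  open import Data.List.Relation.Unary.Any using (here; there)
  open import Data.Bool using (true; false; if_then_else_)
  open import Data.Fin using (Fin)
  open import Data.Product using (∃₂; _×_; _,_)
  open import Relation.Binary.PropositionalEquality
  open import Defs using (dropAt; evenᵇ; sumℤ; detN; det)
  open Sums

  private
    variable
      A B A′ B′ : Set

  sign : ℕ → ℤ
  sign zero = 1ℤ
  sign (suc j) = - sign j

  sign-involutive : ∀ j x → sign j * (sign j * x) ≡ x
  sign-involutive zero x = trans (ℤ.*-identityˡ _) (ℤ.*-identityˡ x)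
  sign-involutive (suc j) x = trans (negate-twice (sign j) x) (sign-involutive j x)
    where
    negate-twice : ∀ s x → - s * (- s * x) ≡ s * (s * x)
    negate-twice = solve-∀

  ∣sign∣ : ∀ j → ∣ sign j ∣ ≡ 1
  ∣sign∣ zero = refl
  ∣sign∣ (suc j) = trans (ℤ.∣-i∣≡∣i∣ (sign j)) (∣sign∣ j)

  -- Laplace expansion along a first row u, where Φ D is the minor of the
  -- remaining rows on the columns D.
  expand : (B → ℤ) → (List B → ℤ) → List B → ℤ
  expand u Φ C = isum (λ j c → sign j * u c * Φ (dropAt j C)) C

  -- The determinant of the submatrix of f on the rows R and columns C, in these
  -- orders; it is meaningful only when length R ≡ length C.
  minor : (A → B → ℤ) → List A → List B → ℤ
  minor f [] = λ _ → 1ℤ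
  minor f (a ∷ R) = expand (f a) (minor f R)

  module _ (u : B → ℤ) where

    expand-cong : ∀ {Φ Ψ : List B → ℤ} C → (∀ D → Φ D ≡ Ψ D) → expand u Φ C ≡ expand u Ψ C
    expand-cong C e = isum-cong C (λ j c → cong (sign j * u c *_) (e (dropAt j C)))

    expand-*ˡ : ∀ ε (Φ : List B → ℤ) C → expand u (λ D → ε * Φ D) C ≡ ε * expand u Φ C
    expand-*ˡ ε Φ C = trans (isum-cong C (λ j c → commute (sign j * u c) ε _)) (isum-*ˡ ε _ C)
      where
      commute : ∀ x y z → x * (y * z) ≡ y * (x * z)
      commute = solve-∀

    expand-- : ∀ a (Φ Ψ : List B → ℤ) C →
      expand u (λ D → a * Φ D - Ψ D) C ≡ a * expand u Φ C - expand u Ψ C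
    expand-- a Φ Ψ C = begin
      isum (λ j c → s j c * (a * Φ (dropAt j C) - Ψ (dropAt j C))) C
        ≡⟨ isum-cong C (λ j c → distrib (s j c) a _ _) ⟩
      isum (λ j c → a * (s j c * Φ (dropAt j C)) + - (s j c * Ψ (dropAt j C))) C
        ≡⟨ isum-+ _ _ C ⟩
      isum (λ j c → a * (s j c * Φ (dropAt j C))) C + isum (λ j c → - (s j c * Ψ (dropAt j C))) C
        ≡⟨ cong₂ _+_ (isum-*ˡ a _ C) (isum-neg _ C) ⟩
      a * expand u Φ C - expand u Ψ C ∎
      where
      open ≡-Reasoning
      s : ℕ → B → ℤ
      s j c = sign j * u c
      distrib : ∀ s a φ ψ → s * (a * φ - ψ) ≡ a * (s * φ) + - (s * ψ)
      distrib = solve-∀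

    expand-∷ : ∀ (Φ : List B → ℤ) x C → expand u Φ (x ∷ C) ≡ u x * Φ C - expand u (Φ ∘ (x ∷_)) C
    expand-∷ Φ x C = cong₂ _+_ (trans (ℤ.*-assoc 1ℤ (u x) _) (ℤ.*-identityˡ _))
      (trans (isum-cong C (λ j c → negate (sign j) (u c) _)) (isum-neg _ C))
      where
      negate : ∀ s v φ → - s * v * φ ≡ - (s * v * φ)
      negate = solve-∀

  expand-∷₂ : ∀ (u v : B → ℤ) Φ x C → expand u (expand v Φ) (x ∷ C)
    ≡ u x * expand v Φ C - v x * expand u Φ C + expand u (expand v (Φ ∘ (x ∷_))) C
  expand-∷₂ u v Φ x C = begin
    expand u (expand v Φ) (x ∷ C)
      ≡⟨ expand-∷ u (expand v Φ) x C ⟩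
    u x * expand v Φ C - expand u (expand v Φ ∘ (x ∷_)) C
      ≡⟨ cong (λ t → u x * expand v Φ C - t)
           (trans (expand-cong u C (λ D → expand-∷ v Φ x D)) (expand-- u (v x) Φ (expand v (Φ ∘ (x ∷_))) C)) ⟩
    u x * expand v Φ C - (v x * expand u Φ C - expand u (expand v (Φ ∘ (x ∷_))) C)
      ≡⟨ regroup (u x * expand v Φ C) (v x * expand u Φ C) _ ⟩
    u x * expand v Φ C - v x * expand u Φ C + expand u (expand v (Φ ∘ (x ∷_))) C ∎
    where
    open ≡-Reasoning
    regroup : ∀ a b c → a - (b - c) ≡ a - b + c
    regroup = solve-∀

  expand-antisym : ∀ (u v : B → ℤ) Φ C → expand u (expand v Φ) C ≡ - expand v (expand u Φ) C
  expand-antisym u v Φ [] = refl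
  expand-antisym {B} u v Φ (x ∷ C) = begin
    expand u (expand v Φ) (x ∷ C)
      ≡⟨ expand-∷₂ u v Φ x C ⟩
    u x * expand v Φ C - v x * expand u Φ C + expand u (expand v Φ′) C
      ≡⟨ cong (_+_ (u x * expand v Φ C - v x * expand u Φ C)) (expand-antisym u v Φ′ C) ⟩
    u x * expand v Φ C - v x * expand u Φ C + - expand v (expand u Φ′) C
      ≡⟨ regroup (u x * expand v Φ C) (v x * expand u Φ C) _ ⟩
    - (v x * expand u Φ C - u x * expand v Φ C + expand v (expand u Φ′) C)
      ≡⟨ cong -_ (expand-∷₂ v u Φ x C) ⟨
    - expand v (expand u Φ) (x ∷ C) ∎
    where
    open ≡-Reasoning
    Φ′ : List B → ℤ
    Φ′ = Φ ∘ (x ∷_)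
    regroup : ∀ a b c → a - b + - c ≡ - (b - a + c)
    regroup = solve-∀

  x≡-x⇒x≡0 : ∀ x → x ≡ - x → x ≡ 0ℤ
  x≡-x⇒x≡0 x e = ℤ.*-cancelˡ-≡ (+ 2) x 0ℤ (trans (double x) (trans (cong (_+_ x) e) (ℤ.+-inverseʳ x)))
    where
    double : ∀ x → + 2 * x ≡ x + x
    double = solve-∀

  swapHead : List A → List A
  swapHead (a ∷ b ∷ r) = b ∷ a ∷ r
  swapHead r = r

  -- Moves the t-th entry to the front by t adjacent transpositions.
  bringToFront : ℕ → List A → List A
  bringToFront zero xs = xs
  bringToFront (suc t) [] = []
  bringToFront (suc t) (x ∷ xs) = swapHead (x ∷ bringToFront t xs)

  length-swapHead : ∀ (xs : List A) → length (swapHead xs) ≡ length xs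
  length-swapHead [] = refl
  length-swapHead (x ∷ []) = refl
  length-swapHead (x ∷ y ∷ xs) = refl

  length-bringToFront : ∀ t (xs : List A) → length (bringToFront t xs) ≡ length xs
  length-bringToFront zero xs = refl
  length-bringToFront (suc t) [] = refl
  length-bringToFront (suc t) (x ∷ xs) =
    trans (length-swapHead (x ∷ bringToFront t xs)) (cong suc (length-bringToFront t xs))

  ∈⇒bringToFront : ∀ {a : A} {xs} → a ∈ xs → ∃₂ λ t r → t < length xs × bringToFront t xs ≡ a ∷ r
  ∈⇒bringToFront {xs = x ∷ xs} (here refl) = 0 , xs , s≤s z≤n , refl
  ∈⇒bringToFront {xs = x ∷ xs} (there a∈) with ∈⇒bringToFront a∈
  ... | t , r , t< , e = suc t , x ∷ r , s≤s t< , cong (λ l → swapHead (x ∷ l)) e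

  length-dropAt : ∀ j (xs : List A) → j < length xs → suc (length (dropAt j xs)) ≡ length xs
  length-dropAt zero (x ∷ xs) _ = refl
  length-dropAt (suc j) (x ∷ xs) (s≤s j<) = cong suc (length-dropAt j xs j<)

  length-dropAt≤ : ∀ j (xs : List A) → length (dropAt j xs) ≤ length xs
  length-dropAt≤ j [] = z≤n
  length-dropAt≤ zero (x ∷ xs) = ℕ.n≤1+n _
  length-dropAt≤ (suc j) (x ∷ xs) = s≤s (length-dropAt≤ j xs)

  dropAt-map : ∀ (g : A → B) j xs → dropAt j (map g xs) ≡ map g (dropAt j xs)
  dropAt-map g j [] = refl
  dropAt-map g zero (x ∷ xs) = refl
  dropAt-map g (suc j) (x ∷ xs) = cong (g x ∷_) (dropAt-map g j xs)

  module _ (f : A → B → ℤ) where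

    minor-swap : ∀ a b R C → minor f (a ∷ b ∷ R) C ≡ - minor f (b ∷ a ∷ R) C
    minor-swap a b R = expand-antisym (f a) (f b) (minor f R)

    minor-∷-scale : ∀ ε a X Y → (∀ C → minor f X C ≡ ε * minor f Y C) →
      ∀ C → minor f (a ∷ X) C ≡ ε * minor f (a ∷ Y) C
    minor-∷-scale ε a X Y e C = trans (expand-cong (f a) C e) (expand-*ˡ (f a) ε (minor f Y) C)

    minor-bringToFront : ∀ t R C → t < length R → minor f (bringToFront t R) C ≡ sign t * minor f R C
    minor-bringToFront zero R C _ = sym (ℤ.*-identityˡ _)
    minor-bringToFront (suc t) (x ∷ xs) C (s≤s t<) with bringToFront t xs in eq
    ... | [] with () ← ℕ.<-≤-trans t< (ℕ.≤-reflexive (trans (sym (length-bringToFront t xs)) (cong length eq)))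
    ... | y ∷ l = begin
      minor f (y ∷ x ∷ l) C                        ≡⟨ minor-swap y x l C ⟩
      - minor f (x ∷ y ∷ l) C                      ≡⟨ cong (λ r → - minor f (x ∷ r) C) eq ⟨
      - minor f (x ∷ bringToFront t xs) C
        ≡⟨ cong -_ (minor-∷-scale (sign t) x (bringToFront t xs) xs (λ C′ → minor-bringToFront t xs C′ t<) C) ⟩
      - (sign t * minor f (x ∷ xs) C)              ≡⟨ ℤ.neg-distribˡ-* (sign t) _ ⟩
      sign (suc t) * minor f (x ∷ xs) C            ∎
      where open ≡-Reasoning

    minor-∷-∈ : ∀ a R C → a ∈ R → minor f (a ∷ R) C ≡ 0ℤ
    minor-∷-∈ a R C a∈R with ∈⇒bringToFront a∈R
    ... | t , r , t< , e = begin
      minor f (a ∷ R) C                                 ≡⟨ sign-involutive t _ ⟨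
      sign t * (sign t * minor f (a ∷ R) C)
        ≡⟨ cong (sign t *_) (minor-∷-scale (sign t) a (bringToFront t R) R (λ C′ → minor-bringToFront t R C′ t<) C) ⟨
      sign t * minor f (a ∷ bringToFront t R) C         ≡⟨ cong (λ l → sign t * minor f (a ∷ l) C) e ⟩
      sign t * minor f (a ∷ a ∷ r) C                    ≡⟨ cong (sign t *_) (x≡-x⇒x≡0 _ (minor-swap a a r C)) ⟩
      sign t * 0ℤ                                       ≡⟨ ℤ.*-zeroʳ (sign t) ⟩
      0ℤ                                                ∎
      where open ≡-Reasoning

    minor-firstColumn : ∀ R c C → length R ≡ suc (length C) →
      minor f R (c ∷ C) ≡ isum (λ i a → sign i * f a c * minor f (dropAt i R) C) R
    minor-firstColumn (a ∷ R) c C e = cong (_+_ (sign 0 * f a c * minor f R C)) (begin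
      isum (λ j c′ → sign (suc j) * f a c′ * minor f R (c ∷ dropAt j C)) C
        ≡⟨ isum-cong-< C (λ j c′ j< → cong (sign (suc j) * f a c′ *_)
             (minor-firstColumn R c (dropAt j C) (trans (ℕ.suc-injective e) (sym (length-dropAt j C j<))))) ⟩
      isum (λ j c′ → sign (suc j) * f a c′ * isum (λ i a′ → sign i * f a′ c * M i j) R) C
        ≡⟨ isum-cong C (λ j c′ → isum-*ˡ (sign (suc j) * f a c′) (λ i a′ → sign i * f a′ c * M i j) R) ⟨
      isum (λ j c′ → isum (λ i a′ → sign (suc j) * f a c′ * (sign i * f a′ c * M i j)) R) C
        ≡⟨ isum-swap _ C R ⟩
      isum (λ i a′ → isum (λ j c′ → sign (suc j) * f a c′ * (sign i * f a′ c * M i j)) C) R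
        ≡⟨ isum-cong R (λ i a′ → trans (isum-cong C (λ j c′ → exchange (sign j) (f a c′) (sign i) (f a′ c) (M i j)))
                                       (isum-*ˡ (sign (suc i) * f a′ c) (λ j c′ → sign j * f a c′ * M i j) C)) ⟩
      isum (λ i a′ → sign (suc i) * f a′ c * minor f (a ∷ dropAt i R) C) R ∎)
      where
      open ≡-Reasoning
      M : ℕ → ℕ → ℤ
      M i j = minor f (dropAt i R) (dropAt j C)
      exchange : ∀ sj x si y m → - sj * x * (si * y * m) ≡ - si * y * (sj * x * m)
      exchange = solve-∀

    minor-transpose : ∀ R C → length R ≡ length C → minor f R C ≡ minor (flip f) C R
    minor-transpose [] [] _ = refl
    minor-transpose R (c ∷ C) e = trans (minor-firstColumn R c C e)
      (isum-cong-< R (λ i a i< → cong (sign i * f a c *_)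
        (minor-transpose (dropAt i R) C (ℕ.suc-injective (trans (length-dropAt i R i<) e)))))

  module _ (f : A → B → ℤ) where

    minor-bringToFrontᶜ : ∀ t R C → length R ≡ length C → t < length C →
      minor f R (bringToFront t C) ≡ sign t * minor f R C
    minor-bringToFrontᶜ t R C e t< = begin
      minor f R (bringToFront t C)      ≡⟨ minor-transpose f R _ (trans e (sym (length-bringToFront t C))) ⟩
      minor (flip f) (bringToFront t C) R ≡⟨ minor-bringToFront (flip f) t C R t< ⟩
      sign t * minor (flip f) C R       ≡⟨ cong (sign t *_) (minor-transpose f R C e) ⟨
      sign t * minor f R C              ∎
      where open ≡-Reasoning

    minor-∷-∈ᶜ : ∀ R c C → length R ≡ suc (length C) → c ∈ C → minor f R (c ∷ C) ≡ 0ℤ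
    minor-∷-∈ᶜ R c C e c∈C = trans (minor-transpose f R (c ∷ C) e) (minor-∷-∈ (flip f) c C R c∈C)

  minor-map : ∀ (f : A′ → B′ → ℤ) (φ : A → A′) (ψ : B → B′) R C →
    minor f (map φ R) (map ψ C) ≡ minor (λ a b → f (φ a) (ψ b)) R C
  minor-map f φ ψ [] C = refl
  minor-map f φ ψ (a ∷ R) C = trans (isum-map _ ψ C) (isum-cong C (λ j c → cong (sign j * f (φ a) (ψ c) *_)
    (trans (cong (minor f (map φ R)) (dropAt-map ψ j C)) (minor-map f φ ψ R (dropAt j C)))))

  module _ {K : ℕ} (f : A → B → ℤ) (∣f∣≤K : ∀ a b → ∣ f a b ∣ ≤ K) where

    ∣minor∣≤ : ∀ R C L → length C ≤ L → ∣ minor f R C ∣ ≤ (K ℕ.* L) ^ length R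
    ∣minor∣≤ [] C L _ = ℕ.≤-refl
    ∣minor∣≤ (a ∷ R) C L C≤L = ℕ.≤-trans (∣isum∣≤ C (λ j c → ∣term∣≤ j c)) (ℕ.≤-trans (ℕ.*-monoˡ-≤ _ C≤L)
      (ℕ.≤-reflexive (trans (sym (ℕ.*-assoc L K _)) (cong (ℕ._* ((K ℕ.* L) ^ length R)) (ℕ.*-comm L K)))))
      where
      bound : ℕ
      bound = K ℕ.* (K ℕ.* L) ^ length R
      ∣isum∣≤ : ∀ {g : ℕ → B → ℤ} xs → (∀ j x → ∣ g j x ∣ ≤ bound) → ∣ isum g xs ∣ ≤ length xs ℕ.* bound
      ∣isum∣≤ [] _ = z≤n
      ∣isum∣≤ {g} (x ∷ xs) le = ℕ.≤-trans (ℤ.∣i+j∣≤∣i∣+∣j∣ (g 0 x) _) (ℕ.+-mono-≤ (le 0 x) (∣isum∣≤ xs (le ∘ suc)))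
      ∣term∣≤ : ∀ j c → ∣ sign j * f a c * minor f R (dropAt j C) ∣ ≤ bound
      ∣term∣≤ j c rewrite ℤ.abs-* (sign j * f a c) (minor f R (dropAt j C)) | ℤ.abs-* (sign j) (f a c)
                       | ∣sign∣ j | ℕ.+-identityʳ ∣ f a c ∣ =
        ℕ.*-mono-≤ (∣f∣≤K a c) (∣minor∣≤ R (dropAt j C) L (ℕ.≤-trans (length-dropAt≤ j C) C≤L))

  sign≡alternating : ∀ j → (if evenᵇ j then 1ℤ else -1ℤ) ≡ sign j
  sign≡alternating zero = refl
  sign≡alternating (suc j) with evenᵇ j | sign≡alternating j
  ... | true | e = cong -_ e
  ... | false | e = cong -_ e

  detN≡minor : ∀ (f : A → B → ℤ) R C → detN (length R) (map (λ a → map (f a) C) R) ≡ minor f R C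
  detN≡minor f [] C = refl
  detN≡minor f (a ∷ R) C = trans (sumℤ-zipWith _ (λ j → j) (map (f a) C)) (trans (isum-map _ (f a) C)
    (isum-cong C (λ j c → cong₂ (λ s m → s * f a c * m) (sign≡alternating j)
      (trans (cong (detN (length R)) (trans (sym (List.map-∘ R)) (List.map-cong (λ a′ → dropAt-map (f a′) j C) R)))
             (detN≡minor f R (dropAt j C))))))
    where
    sumℤ-zipWith : ∀ (g : ℕ → ℤ → ℤ) (h : ℕ → ℕ) r →
      sumℤ (zipWith g (applyUpTo h (length r)) r) ≡ isum (λ j → g (h j)) r
    sumℤ-zipWith g h [] = refl
    sumℤ-zipWith g h (x ∷ r) = cong (_+_ (g (h 0) x)) (sumℤ-zipWith g (h ∘ suc) r)

  det≡minor : ∀ {n} (R : List (Fin n → ℤ)) C → det (map (λ v → map v C) R) ≡ minor (λ v c → v c) R C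
  det≡minor R C = trans (cong (λ l → detN l (map (λ v → map v C) R)) (List.length-map (λ v → map v C) R))
                        (detN≡minor (λ v c → v c) R C)

module Sublists where

  open import Data.Nat using (ℕ; suc; _<_; _≤_; z≤n; s≤s)
  import Data.Nat.Properties as ℕ
  open import Data.List using (List; []; _∷_; map; length; filterᵇ)
  open import Data.List.Membership.Propositional using (_∈_; _∉_)
  open import Data.List.Membership.Propositional.Properties using (∈-map⁺; ∈-map⁻; ∈-++⁺ˡ; ∈-++⁺ʳ; ∈-++⁻)
  open import Data.List.Relation.Unary.Any using (here; there)
  open import Data.List.Relation.Unary.All using ([]; _∷_)
  import Data.List.Relation.Unary.All.Properties as All
  open import Data.List.Relation.Unary.AllPairs using ([]; _∷_)
  open import Data.List.Relation.Unary.Unique.Propositional using (Unique)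
  open import Data.Bool using (true; false)
  open import Data.Product as Product using (∃; ∃₂; _×_; _,_; proj₂)
  import Data.List.Properties as List
  import Data.List.Relation.Unary.Unique.Propositional.Properties as Unique
  open import Relation.Nullary using (¬_)
  open import Data.Sum using (_⊎_; inj₁; inj₂)
  open import Data.Empty using (⊥-elim)
  open import Relation.Binary.PropositionalEquality
  open import Defs using (sublists)
  open Determinant using (bringToFront; swapHead)

  private
    variable
      A B : Set

  ∈-sublists-∷⁻ : ∀ (x : A) xs {R} → R ∈ sublists (x ∷ xs) →
    R ∈ sublists xs ⊎ ∃ λ R′ → R′ ∈ sublists xs × R ≡ x ∷ R′
  ∈-sublists-∷⁻ x xs R∈ with ∈-++⁻ (sublists xs) R∈
  ... | inj₁ R∈′ = inj₁ R∈′
  ... | inj₂ R∈′ with ∈-map⁻ (x ∷_) R∈′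
  ... | R′ , R′∈ , e = inj₂ (R′ , R′∈ , e)

  ∈-sublists-skip : ∀ (x : A) xs {R} → R ∈ sublists xs → R ∈ sublists (x ∷ xs)
  ∈-sublists-skip x xs = ∈-++⁺ˡ

  ∈-sublists-keep : ∀ (x : A) xs {R} → R ∈ sublists xs → x ∷ R ∈ sublists (x ∷ xs)
  ∈-sublists-keep x xs R∈ = ∈-++⁺ʳ (sublists xs) (∈-map⁺ (x ∷_) R∈)

  []∈sublists : ∀ (xs : List A) → [] ∈ sublists xs
  []∈sublists [] = here refl
  []∈sublists (x ∷ xs) = ∈-sublists-skip x xs ([]∈sublists xs)

  [x]∈sublists : ∀ {x : A} xs → x ∈ xs → x ∷ [] ∈ sublists xs
  [x]∈sublists (y ∷ ys) (here refl) = ∈-sublists-keep y ys ([]∈sublists ys)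
  [x]∈sublists (y ∷ ys) (there x∈) = ∈-sublists-skip y ys ([x]∈sublists ys x∈)

  filterᵇ∈sublists : ∀ P (xs : List A) → filterᵇ P xs ∈ sublists xs
  filterᵇ∈sublists P [] = here refl
  filterᵇ∈sublists P (x ∷ xs) with P x
  ... | true = ∈-sublists-keep x xs (filterᵇ∈sublists P xs)
  ... | false = ∈-sublists-skip x xs (filterᵇ∈sublists P xs)

  ∈-sublists⇒length≤ : ∀ (xs : List A) {R} → R ∈ sublists xs → length R ≤ length xs
  ∈-sublists⇒length≤ [] (here refl) = z≤n
  ∈-sublists⇒length≤ (x ∷ xs) R∈ with ∈-sublists-∷⁻ x xs R∈
  ... | inj₁ R∈′ = ℕ.m≤n⇒m≤1+n (∈-sublists⇒length≤ xs R∈′)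
  ... | inj₂ (R′ , R′∈ , refl) = s≤s (∈-sublists⇒length≤ xs R′∈)

  ∈-sublists⇒⊆ : ∀ (xs : List A) {R y} → R ∈ sublists xs → y ∈ R → y ∈ xs
  ∈-sublists⇒⊆ [] (here refl) ()
  ∈-sublists⇒⊆ (x ∷ xs) R∈ y∈R with ∈-sublists-∷⁻ x xs R∈
  ... | inj₁ R∈′ = there (∈-sublists⇒⊆ xs R∈′ y∈R)
  ... | inj₂ (R′ , R′∈ , refl) with y∈R
  ... | here y≡x = here y≡x
  ... | there y∈R′ = there (∈-sublists⇒⊆ xs R′∈ y∈R′)

  ∈-sublists-map⁺ : ∀ (g : A → B) xs {R} → R ∈ sublists xs → map g R ∈ sublists (map g xs)
  ∈-sublists-map⁺ g [] (here refl) = here refl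
  ∈-sublists-map⁺ g (x ∷ xs) R∈ with ∈-sublists-∷⁻ x xs R∈
  ... | inj₁ R∈′ = ∈-sublists-skip (g x) (map g xs) (∈-sublists-map⁺ g xs R∈′)
  ... | inj₂ (R′ , R′∈ , refl) = ∈-sublists-keep (g x) (map g xs) (∈-sublists-map⁺ g xs R′∈)

  ∈-sublists-map⁻ : ∀ (g : A → B) xs {R} → R ∈ sublists (map g xs) →
    ∃ λ R₀ → R₀ ∈ sublists xs × R ≡ map g R₀
  ∈-sublists-map⁻ g [] (here refl) = [] , here refl , refl
  ∈-sublists-map⁻ g (x ∷ xs) R∈ with ∈-sublists-∷⁻ (g x) (map g xs) R∈
  ... | inj₁ R∈′ with ∈-sublists-map⁻ g xs R∈′
  ... | R₀ , R₀∈ , e = R₀ , ∈-sublists-skip x xs R₀∈ , e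
  ∈-sublists-map⁻ g (x ∷ xs) R∈ | inj₂ (R′ , R′∈ , refl) with ∈-sublists-map⁻ g xs R′∈
  ... | R₀ , R₀∈ , e = x ∷ R₀ , ∈-sublists-keep x xs R₀∈ , cong (g x ∷_) e

  ∈-sublists-insert : ∀ (xs : List A) {C c} → C ∈ sublists xs → c ∈ xs → c ∉ C →
    ∃₂ λ C′ t → C′ ∈ sublists xs × t < length C′ × bringToFront t C′ ≡ c ∷ C
  ∈-sublists-insert (x ∷ xs) {C} C∈ (here refl) c∉C with ∈-sublists-∷⁻ x xs C∈
  ... | inj₁ C∈′ = x ∷ C , 0 , ∈-sublists-keep x xs C∈′ , s≤s z≤n , refl
  ... | inj₂ (C′ , _ , refl) = ⊥-elim (c∉C (here refl))
  ∈-sublists-insert (x ∷ xs) {C} C∈ (there c∈) c∉C with ∈-sublists-∷⁻ x xs C∈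
  ... | inj₁ C∈′ with ∈-sublists-insert xs C∈′ c∈ c∉C
  ... | C′ , t , C′∈ , t< , e = C′ , t , ∈-sublists-skip x xs C′∈ , t< , e
  ∈-sublists-insert (x ∷ xs) {C} C∈ (there c∈) c∉C | inj₂ (C₀ , C₀∈ , refl)
    with ∈-sublists-insert xs C₀∈ c∈ (λ c∈C₀ → c∉C (there c∈C₀))
  ... | C′ , t , C′∈ , t< , e = x ∷ C′ , suc t , ∈-sublists-keep x xs C′∈ , s≤s t< , cong (λ l → swapHead (x ∷ l)) e

  ∈-sublists-unique : ∀ (L : List A) → Unique L → ∀ {X Y} → X ∈ sublists L → Y ∈ sublists L →
    (∀ {x} → x ∈ X → x ∈ Y) → (∀ {x} → x ∈ Y → x ∈ X) → X ≡ Y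
  ∈-sublists-unique [] _ (here refl) (here refl) _ _ = refl
  ∈-sublists-unique (l ∷ L) (l∉L ∷ u) X∈ Y∈ X⊆Y Y⊆X with ∈-sublists-∷⁻ l L X∈ | ∈-sublists-∷⁻ l L Y∈
  ... | inj₁ X∈′ | inj₁ Y∈′ = ∈-sublists-unique L u X∈′ Y∈′ X⊆Y Y⊆X
  ... | inj₁ X∈′ | inj₂ (_ , _ , refl) = ⊥-elim (All.All¬⇒¬Any l∉L (∈-sublists⇒⊆ L X∈′ (Y⊆X (here refl))))
  ... | inj₂ (_ , _ , refl) | inj₁ Y∈′ = ⊥-elim (All.All¬⇒¬Any l∉L (∈-sublists⇒⊆ L Y∈′ (X⊆Y (here refl))))
  ... | inj₂ (X′ , X′∈ , refl) | inj₂ (Y′ , Y′∈ , refl) =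
    cong (l ∷_) (∈-sublists-unique L u X′∈ Y′∈ (drop-head X′∈ X⊆Y) (drop-head Y′∈ Y⊆X))
    where
    drop-head : ∀ {P Q} → P ∈ sublists L → (∀ {x} → x ∈ l ∷ P → x ∈ l ∷ Q) → ∀ {x} → x ∈ P → x ∈ Q
    drop-head P∈ P⊆Q x∈P with P⊆Q (there x∈P)
    ... | here refl = ⊥-elim (All.All¬⇒¬Any l∉L (∈-sublists⇒⊆ L P∈ x∈P))
    ... | there x∈Q = x∈Q

  sublists-unique : ∀ (L : List A) → Unique L → Unique (sublists L)
  sublists-unique [] _ = [] ∷ []
  sublists-unique (l ∷ L) (l∉L ∷ u) =
    Unique.++⁺ (sublists-unique L u) (Unique.map⁺ (λ e → proj₂ (List.∷-injective e)) (sublists-unique L u)) disjoint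
    where
    disjoint : ∀ {R} → ¬ (R ∈ sublists L × R ∈ map (l ∷_) (sublists L))
    disjoint (R∈ , R∈′) with ∈-map⁻ (l ∷_) R∈′
    ... | _ , _ , refl = All.All¬⇒¬Any l∉L (∈-sublists⇒⊆ L R∈ (here refl))

  indexed : List A → List (ℕ × A)
  indexed [] = []
  indexed (x ∷ xs) = (0 , x) ∷ map (Product.map₁ suc) (indexed xs)

  map-proj₂-indexed : ∀ (xs : List A) → map proj₂ (indexed xs) ≡ xs
  map-proj₂-indexed [] = refl
  map-proj₂-indexed (x ∷ xs) = cong (x ∷_) (trans (sym (List.map-∘ (indexed xs))) (map-proj₂-indexed xs))

module Congruence where

  open import Data.Nat as ℕ using (ℕ; zero; suc; _<_; NonZero)
  import Data.Nat.Properties as ℕ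
  import Data.Nat.Divisibility as ℕ
  open import Data.Nat.Primality using (Prime; euclidsLemma; prime⇒irreducible)
  open import Data.Nat.Coprimality using (Coprime; coprime-Bézout)
  open import Data.Nat.GCD using (module Bézout)
  open import Data.Integer using (ℤ; +_; 0ℤ; 1ℤ; -_; _-_; _+_; _*_; ∣_∣)
  import Data.Integer.Properties as ℤ
  open import Data.Integer.DivMod using (_%ℕ_; _/ℕ_; n%ℕd<d; a≡a%ℕn+[a/ℕn]*n)
  open import Data.Integer.Divisibility.Signed
    using (_∣_; divides; ∣ᵤ⇒∣; ∣⇒∣ᵤ; ∣m∣n⇒∣m+n; ∣m⇒∣-m; ∣n⇒∣m*n)
  open import Data.Integer.Tactic.RingSolver using (solve-∀)
  open import Data.Fin using (Fin; toℕ; fromℕ<)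
  import Data.Fin.Properties as Fin
  open import Data.List using (List; allFin)
  open import Data.List.Membership.Propositional using (_∈_)
  open import Data.List.Relation.Unary.Any using (here; there)
  open import Data.Product using (∃; _,_)
  open import Data.Sum using (_⊎_; inj₁; inj₂)
  open import Data.Empty using (⊥-elim)
  open import Relation.Nullary using (¬_)
  open import Relation.Binary.Bundles using (Setoid)
  import Relation.Binary.Reasoning.Setoid as SetoidReasoning
  open import Relation.Binary.PropositionalEquality
  open Sums

  ∣-resp-≡ : ∀ {d a b} → a ≡ b → d ∣ a → d ∣ b
  ∣-resp-≡ refl d∣a = d∣a

  ∣-isum : ∀ {d} {A : Set} (f : ℕ → A → ℤ) xs → (∀ j x → x ∈ xs → d ∣ f j x) → d ∣ isum f xs
  ∣-isum f List.[] _ = divides 0ℤ refl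
  ∣-isum f (x List.∷ xs) d∣f =
    ∣m∣n⇒∣m+n (d∣f 0 x (here refl)) (∣-isum (λ j → f (suc j)) xs (λ j y y∈ → d∣f (suc j) y (there y∈)))

  pos-Bézout : ∀ a b c d → 1 ℕ.+ a ℕ.* b ≡ c ℕ.* d → 1ℤ + + a * + b ≡ + c * + d
  pos-Bézout a b c d e = trans (cong (_+_ 1ℤ) (sym (ℤ.pos-* a b))) (trans (cong +_ e) (ℤ.pos-* c d))

  module Mod (p : ℕ) where

    -- A record rather than a synonym for + p ∣ a - b, so that a ≈ b
    -- determines a and b during unification.
    infix 4 _≈_
    record _≈_ (a b : ℤ) : Set where
      constructor mod
      field ∣-diff : + p ∣ a - b
    open _≈_ public

    ≈-reflexive : ∀ {a b} → a ≡ b → a ≈ b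
    ≈-reflexive {a} refl = mod (divides 0ℤ (ℤ.+-inverseʳ a))

    ≈-sym : ∀ {a b} → a ≈ b → b ≈ a
    ≈-sym {a} {b} (mod a-b) = mod (∣-resp-≡ (flip a b) (∣m⇒∣-m a-b))
      where
      flip : ∀ a b → - (a - b) ≡ b - a
      flip = solve-∀

    ≈-trans : ∀ {a b c} → a ≈ b → b ≈ c → a ≈ c
    ≈-trans {a} {b} {c} (mod a-b) (mod b-c) = mod (∣-resp-≡ (telescope a b c) (∣m∣n⇒∣m+n a-b b-c))
      where
      telescope : ∀ a b c → a - b + (b - c) ≡ a - c
      telescope = solve-∀

    ≈-setoid : Setoid _ _
    ≈-setoid = record
      { Carrier = ℤ
      ; _≈_ = _≈_
      ; isEquivalence = record { refl = ≈-reflexive refl ; sym = ≈-sym ; trans = ≈-trans }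
      }

    module ≈-Reasoning = SetoidReasoning ≈-setoid

    +-cong-≈ : ∀ {a b c d} → a ≈ b → c ≈ d → a + c ≈ b + d
    +-cong-≈ {a} {b} {c} {d} (mod a-b) (mod c-d) = mod (∣-resp-≡ (regroup a b c d) (∣m∣n⇒∣m+n a-b c-d))
      where
      regroup : ∀ a b c d → a - b + (c - d) ≡ a + c - (b + d)
      regroup = solve-∀

    +-congʳ-≈ : ∀ c {a b} → a ≈ b → a + c ≈ b + c
    +-congʳ-≈ c a≈b = +-cong-≈ a≈b (≈-reflexive refl)

    +-congˡ-≈ : ∀ c {a b} → a ≈ b → c + a ≈ c + b
    +-congˡ-≈ c a≈b = +-cong-≈ (≈-reflexive {c} refl) a≈b

    ∣⇒≈0 : ∀ {a} → + p ∣ a → a ≈ 0ℤ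
    ∣⇒≈0 {a} p∣a = mod (∣-resp-≡ (sym (ℤ.+-identityʳ a)) p∣a)

    *-congˡ-≈ : ∀ c {a b} → a ≈ b → c * a ≈ c * b
    *-congˡ-≈ c {a} {b} (mod a-b) = mod (∣-resp-≡ (distrib c a b) (∣n⇒∣m*n c a-b))
      where
      distrib : ∀ c a b → c * (a - b) ≡ c * a - c * b
      distrib = solve-∀

    ∣-resp-≈ : ∀ {a b} → a ≈ b → + p ∣ a → + p ∣ b
    ∣-resp-≈ {a} {b} (mod a-b) p∣a = ∣-resp-≡ (cancel a b) (∣m∣n⇒∣m+n p∣a (∣m⇒∣-m a-b))
      where
      cancel : ∀ a b → a + - (a - b) ≡ b
      cancel = solve-∀

    isum-cong-≈ : ∀ {A : Set} (f g : ℕ → A → ℤ) xs → (∀ j x → f j x ≈ g j x) → isum f xs ≈ isum g xs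
    isum-cong-≈ f g List.[] _ = ≈-reflexive refl
    isum-cong-≈ f g (x List.∷ xs) f≈g =
      +-cong-≈ (f≈g 0 x) (isum-cong-≈ (λ j → f (suc j)) (λ j → g (suc j)) xs (λ j → f≈g (suc j)))

    ∣-small⇒≡0 : ∀ {i} → + p ∣ i → ∣ i ∣ < p → i ≡ 0ℤ
    ∣-small⇒≡0 {i} p∣i ∣i∣<p with ∣ i ∣ in ∣i∣≡
    ... | zero = ℤ.∣i∣≡0⇒i≡0 ∣i∣≡
    ... | suc _ = ⊥-elim (ℕ.<⇒≱ ∣i∣<p (ℕ.∣⇒≤ (subst (p ℕ.∣_) ∣i∣≡ (∣⇒∣ᵤ p∣i))))

    dot-congʳ-≈ : ∀ {n} (ρ : Fin n → ℤ) {a b : Fin n → ℤ} → (∀ c → a c ≈ b c) → dot ρ a ≈ dot ρ b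
    dot-congʳ-≈ {n} ρ a≈b = isum-cong-≈ _ _ (allFin n) (λ _ c → *-congˡ-≈ (ρ c) (a≈b c))

    module _ .{{_ : NonZero p}} where

      reduce : ℤ → Fin p
      reduce z = fromℕ< (n%ℕd<d z p)

      reduce-≈ : ∀ z → + toℕ (reduce z) ≈ z
      reduce-≈ z = mod (divides (- (z /ℕ p)) (begin
        + toℕ (reduce z) - z               ≡⟨ cong (λ r → + r - z) (Fin.toℕ-fromℕ< (n%ℕd<d z p)) ⟩
        + (z %ℕ p) - z                     ≡⟨ cong (λ y → + (z %ℕ p) - y) (a≡a%ℕn+[a/ℕn]*n z p) ⟩
        + (z %ℕ p) - (+ (z %ℕ p) + z /ℕ p * + p) ≡⟨ cancel (+ (z %ℕ p)) (z /ℕ p) (+ p) ⟩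
        - (z /ℕ p) * + p                   ∎))
        where
        open ≡-Reasoning
        cancel : ∀ r q p → r - (r + q * p) ≡ - q * p
        cancel = solve-∀

      toℕ-≈⇒≡ : ∀ (x y : Fin p) → + toℕ x ≈ + toℕ y → x ≡ y
      toℕ-≈⇒≡ x y x≈y = Fin.toℕ-injective (ℤ.+-injective (ℤ.i-j≡0⇒i≡j _ _ (∣-small⇒≡0 (∣-diff x≈y) small)))
        where
        small : ∣ + toℕ x - + toℕ y ∣ < p
        small = ℕ.≤-<-trans (ℕ.≤-reflexive (cong ∣_∣ (ℤ.m-n≡m⊖n (toℕ x) (toℕ y))))
                  (ℕ.≤-<-trans (ℤ.∣m⊝n∣≤m⊔n (toℕ x) (toℕ y)) (ℕ.⊔-lub (Fin.toℕ<n x) (Fin.toℕ<n y)))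

      reduce-cong : ∀ {a b} → a ≈ b → reduce a ≡ reduce b
      reduce-cong {a} {b} a≈b = toℕ-≈⇒≡ (reduce a) (reduce b)
        (≈-trans (reduce-≈ a) (≈-trans a≈b (≈-sym (reduce-≈ b))))

      reduce-toℕ : ∀ x → reduce (+ toℕ x) ≡ x
      reduce-toℕ x = toℕ-≈⇒≡ (reduce (+ toℕ x)) x (reduce-≈ (+ toℕ x))

    module _ (prime : Prime p) where

      ∣*⇒∣⊎∣ : ∀ a b → + p ∣ a * b → (+ p ∣ a) ⊎ (+ p ∣ b)
      ∣*⇒∣⊎∣ a b p∣ab with euclidsLemma ∣ a ∣ ∣ b ∣ prime (subst (p ℕ.∣_) (ℤ.abs-* a b) (∣⇒∣ᵤ p∣ab))
      ... | inj₁ p∣a = inj₁ (∣ᵤ⇒∣ p∣a)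
      ... | inj₂ p∣b = inj₂ (∣ᵤ⇒∣ p∣b)

      ∤-cancelˡ : ∀ d a → ¬ + p ∣ d → + p ∣ d * a → + p ∣ a
      ∤-cancelˡ d a p∤d p∣da with ∣*⇒∣⊎∣ d a p∣da
      ... | inj₁ p∣d = ⊥-elim (p∤d p∣d)
      ... | inj₂ p∣a = p∣a

      ∤⇒coprime : ∀ {m} → ¬ p ℕ.∣ m → Coprime p m
      ∤⇒coprime p∤m (i∣p , i∣m) with prime⇒irreducible prime i∣p
      ... | inj₁ i≡1 = i≡1
      ... | inj₂ refl = ⊥-elim (p∤m i∣m)

      ∃-inverse-ℕ : ∀ m → ¬ p ℕ.∣ m → ∃ λ e → e * + m ≈ 1ℤ
      ∃-inverse-ℕ m p∤m with coprime-Bézout (∤⇒coprime p∤m)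
      ... | Bézout.+- x y eq = - + y , mod (divides (- + x)
              (trans (negated (+ y) (+ m)) (trans (cong -_ (pos-Bézout y m x p eq)) (ℤ.neg-distribˡ-* (+ x) (+ p)))))
        where
        negated : ∀ y m → - y * m - 1ℤ ≡ - (1ℤ + y * m)
        negated = solve-∀
      ... | Bézout.-+ x y eq = + y , mod (divides (+ x) (trans (cong (_- 1ℤ) (sym (pos-Bézout x p y m eq))) (cancel (+ x * + p))))
        where
        cancel : ∀ a → 1ℤ + a - 1ℤ ≡ a
        cancel = solve-∀

      ∃-inverse : ∀ d → ¬ + p ∣ d → ∃ λ e → e * d ≈ 1ℤ
      ∃-inverse d p∤d with ∃-inverse-ℕ ∣ d ∣ (λ p∣∣d∣ → p∤d (∣ᵤ⇒∣ p∣∣d∣)) | ℤ.+∣i∣≡i⊎+∣i∣≡-i d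
      ... | e , e∣d∣≈1 | inj₁ +∣d∣≡d = e , subst (λ z → e * z ≈ 1ℤ) +∣d∣≡d e∣d∣≈1
      ... | e , e∣d∣≈1 | inj₂ +∣d∣≡-d = - e , subst (_≈ 1ℤ) (trans (cong (e *_) +∣d∣≡-d) (swap-sign e d)) e∣d∣≈1
        where
        swap-sign : ∀ e d → e * - d ≡ - e * d
        swap-sign = solve-∀

module Counting where

  open import Function using (_∘_; id)
  open import Data.Nat as ℕ using (ℕ; zero; suc; _+_; _*_; _^_; _≤_)
  import Data.Nat.Properties as ℕ
  open import Data.Fin as Fin using (Fin)
  open import Data.List using (List; []; _∷_; _++_; map; length; concatMap; filterᵇ; allFin; tabulate)
  open import Data.Bool using (Bool; true; false; T; if_then_else_; _∧_)
  open import Data.Bool.Properties using (T-≡)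
  open import Function.Bundles using (Equivalence)
  open import Data.Empty using (⊥-elim)
  open import Relation.Nullary using (¬_)
  open import Data.Vec as Vec using (Vec)
  open import Data.List.Membership.Propositional using (_∈_)
  open import Data.List.Relation.Unary.Any using (here; there)
  open import Relation.Binary.PropositionalEquality
  open import Data.Nat.Tactic.RingSolver using (solve-∀)
  open import Algebra.Properties.CommutativeMonoid.Sum ℕ.+-0-commutativeMonoid using (sum)
  open import Defs using (allVecs; listsOfLength)

  private
    variable
      A B : Set

  sumByℕ : (A → ℕ) → List A → ℕ
  sumByℕ f [] = 0
  sumByℕ f (x ∷ xs) = f x + sumByℕ f xs

  indicator : Bool → ℕ
  indicator b = if b then 1 else 0

  sumByℕ-cong : ∀ {f g : A → ℕ} xs → (∀ x → f x ≡ g x) → sumByℕ f xs ≡ sumByℕ g xs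
  sumByℕ-cong [] e = refl
  sumByℕ-cong (x ∷ xs) e = cong₂ _+_ (e x) (sumByℕ-cong xs e)

  sumByℕ-++ : ∀ (f : A → ℕ) xs ys → sumByℕ f (xs ++ ys) ≡ sumByℕ f xs + sumByℕ f ys
  sumByℕ-++ f [] ys = refl
  sumByℕ-++ f (x ∷ xs) ys = trans (cong (_+_ (f x)) (sumByℕ-++ f xs ys)) (sym (ℕ.+-assoc (f x) _ _))

  sumByℕ-+ : ∀ (f g : A → ℕ) xs → sumByℕ (λ x → f x + g x) xs ≡ sumByℕ f xs + sumByℕ g xs
  sumByℕ-+ f g [] = refl
  sumByℕ-+ f g (x ∷ xs) = trans (cong (_+_ (f x + g x)) (sumByℕ-+ f g xs)) (interchange (f x) (g x) _ _)
    where
    interchange : ∀ a b c d → a + b + (c + d) ≡ a + c + (b + d)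
    interchange = solve-∀

  sumByℕ-*ˡ : ∀ c (f : A → ℕ) xs → sumByℕ (λ x → c * f x) xs ≡ c * sumByℕ f xs
  sumByℕ-*ˡ c f [] = sym (ℕ.*-zeroʳ c)
  sumByℕ-*ˡ c f (x ∷ xs) = trans (cong (_+_ (c * f x)) (sumByℕ-*ˡ c f xs)) (sym (ℕ.*-distribˡ-+ c (f x) _))

  sumByℕ-const : ∀ c (xs : List A) → sumByℕ (λ _ → c) xs ≡ length xs * c
  sumByℕ-const c [] = refl
  sumByℕ-const c (x ∷ xs) = cong (_+_ c) (sumByℕ-const c xs)

  sumByℕ-map : ∀ (f : B → ℕ) (g : A → B) xs → sumByℕ f (map g xs) ≡ sumByℕ (f ∘ g) xs
  sumByℕ-map f g [] = refl
  sumByℕ-map f g (x ∷ xs) = cong (_+_ (f (g x))) (sumByℕ-map f g xs)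

  sumByℕ-concatMap : ∀ (f : B → ℕ) (g : A → List B) xs →
    sumByℕ f (concatMap g xs) ≡ sumByℕ (λ x → sumByℕ f (g x)) xs
  sumByℕ-concatMap f g [] = refl
  sumByℕ-concatMap f g (x ∷ xs) = trans (sumByℕ-++ f (g x) _) (cong (_+_ (sumByℕ f (g x))) (sumByℕ-concatMap f g xs))

  sumByℕ-swap : ∀ (h : A → B → ℕ) xs ys →
    sumByℕ (λ x → sumByℕ (h x) ys) xs ≡ sumByℕ (λ y → sumByℕ (λ x → h x y) xs) ys
  sumByℕ-swap h [] ys = sym (trans (sumByℕ-const 0 ys) (ℕ.*-zeroʳ (length ys)))
  sumByℕ-swap h (x ∷ xs) ys = trans (cong (_+_ (sumByℕ (h x) ys)) (sumByℕ-swap h xs ys)) (sym (sumByℕ-+ (h x) _ ys))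

  length≡sumByℕ : ∀ (xs : List A) → length xs ≡ sumByℕ (λ _ → 1) xs
  length≡sumByℕ [] = refl
  length≡sumByℕ (x ∷ xs) = cong suc (length≡sumByℕ xs)

  length-filterᵇ : ∀ (P : A → Bool) xs → length (filterᵇ P xs) ≡ sumByℕ (indicator ∘ P) xs
  length-filterᵇ P [] = refl
  length-filterᵇ P (x ∷ xs) with P x
  ... | true = cong suc (length-filterᵇ P xs)
  ... | false = length-filterᵇ P xs

  indicator-∧ : ∀ a b → indicator (a ∧ b) ≡ indicator a * indicator b
  indicator-∧ true b = sym (ℕ.+-identityʳ (indicator b))
  indicator-∧ false b = refl

  sumByℕ-allFin : ∀ n (h : Fin n → ℕ) → sumByℕ h (allFin n) ≡ sum h
  sumByℕ-allFin n h = go n id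
    where
    go : ∀ m (g : Fin m → Fin n) → sumByℕ h (tabulate g) ≡ sum (h ∘ g)
    go zero g = refl
    go (suc m) g = cong (_+_ (h (g Fin.zero))) (go m (g ∘ Fin.suc))

  length-power : ∀ {C : ℕ → Set} (enum : ∀ ℓ → List A → List (C ℓ)) (cons : ∀ {ℓ} → A → C ℓ → C (suc ℓ)) →
    (∀ xs → length (enum zero xs) ≡ 1) →
    (∀ ℓ xs → enum (suc ℓ) xs ≡ concatMap (λ x → map (cons x) (enum ℓ xs)) xs) →
    ∀ ℓ xs → length (enum ℓ xs) ≡ length xs ^ ℓ
  length-power enum cons base step zero xs = base xs
  length-power enum cons base step (suc ℓ) xs = begin
    length (enum (suc ℓ) xs)
      ≡⟨ cong length (step ℓ xs) ⟩
    length (concatMap (λ x → map (cons x) (enum ℓ xs)) xs)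
      ≡⟨ length≡sumByℕ (concatMap (λ x → map (cons x) (enum ℓ xs)) xs) ⟩
    sumByℕ (λ _ → 1) (concatMap (λ x → map (cons x) (enum ℓ xs)) xs)
      ≡⟨ sumByℕ-concatMap _ _ xs ⟩
    sumByℕ (λ x → sumByℕ (λ _ → 1) (map (cons x) (enum ℓ xs))) xs
      ≡⟨ sumByℕ-cong xs (λ x → trans (sumByℕ-map _ (cons x) (enum ℓ xs)) (sym (length≡sumByℕ (enum ℓ xs)))) ⟩
    sumByℕ (λ _ → length (enum ℓ xs)) xs
      ≡⟨ sumByℕ-const _ xs ⟩
    length xs * length (enum ℓ xs)
      ≡⟨ cong (length xs *_) (length-power enum cons base step ℓ xs) ⟩
    length xs ^ suc ℓ ∎
    where open ≡-Reasoning

  length-allVecs : ∀ ℓ (xs : List A) → length (allVecs ℓ xs) ≡ length xs ^ ℓ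
  length-allVecs = length-power allVecs Vec._∷_ (λ _ → refl) (λ _ _ → refl)

  length-listsOfLength : ∀ ℓ (xs : List A) → length (listsOfLength ℓ xs) ≡ length xs ^ ℓ
  length-listsOfLength = length-power {C = λ _ → List _} (λ ℓ → listsOfLength ℓ) _∷_ (λ _ → refl) (λ _ _ → refl)

  TranslationInvariant : List A → (A → A → A) → Set
  TranslationInvariant {A} xs _∙_ = ∀ (h : A → ℕ) t → sumByℕ (λ x → h (x ∙ t)) xs ≡ sumByℕ h xs

  allVecs-translationInvariant : ∀ {xs : List A} {_∙_} → TranslationInvariant xs _∙_ →
    ∀ ℓ → TranslationInvariant (allVecs ℓ xs) (Vec.zipWith _∙_)
  allVecs-translationInvariant ti zero h Vec.[] = refl
  allVecs-translationInvariant {A} {xs} {_∙_} ti (suc ℓ) h (t Vec.∷ ts) = begin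
    sumByℕ (λ W → h (Vec.zipWith _∙_ W (t Vec.∷ ts))) (concatMap (λ x → map (x Vec.∷_) (allVecs ℓ xs)) xs)
      ≡⟨ sumByℕ-concatMap _ _ xs ⟩
    sumByℕ (λ x → sumByℕ (λ W → h (Vec.zipWith _∙_ W (t Vec.∷ ts))) (map (x Vec.∷_) (allVecs ℓ xs))) xs
      ≡⟨ sumByℕ-cong xs (λ x → trans (sumByℕ-map _ _ (allVecs ℓ xs))
           (allVecs-translationInvariant ti ℓ (λ W → h ((x ∙ t) Vec.∷ W)) ts)) ⟩
    sumByℕ (λ x → tails (x ∙ t)) xs
      ≡⟨ ti tails t ⟩
    sumByℕ tails xs
      ≡⟨ sumByℕ-cong xs (λ x → sym (sumByℕ-map _ _ (allVecs ℓ xs))) ⟩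
    sumByℕ (λ x → sumByℕ h (map (x Vec.∷_) (allVecs ℓ xs))) xs
      ≡⟨ sumByℕ-concatMap _ _ xs ⟨
    sumByℕ h (concatMap (λ x → map (x Vec.∷_) (allVecs ℓ xs)) xs) ∎
    where
    open ≡-Reasoning
    tails : A → ℕ
    tails y = sumByℕ (λ W → h (y Vec.∷ W)) (allVecs ℓ xs)

  count-product : ∀ {C : Set} (cons : A → B → C) (P : A → Bool) (Q : B → Bool) (R : C → Bool) xs ys →
    (∀ x y → R (cons x y) ≡ P x ∧ Q y) → sumByℕ (indicator ∘ Q) ys ≡ 1 →
    sumByℕ (indicator ∘ R) (concatMap (λ x → map (cons x) ys) xs) ≡ sumByℕ (indicator ∘ P) xs
  count-product cons P Q R xs ys R≡ Q-once = begin
    sumByℕ (indicator ∘ R) (concatMap (λ x → map (cons x) ys) xs)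
      ≡⟨ sumByℕ-concatMap _ _ xs ⟩
    sumByℕ (λ x → sumByℕ (indicator ∘ R) (map (cons x) ys)) xs
      ≡⟨ sumByℕ-cong xs (λ x → begin
           sumByℕ (indicator ∘ R) (map (cons x) ys)            ≡⟨ sumByℕ-map _ (cons x) ys ⟩
           sumByℕ (λ y → indicator (R (cons x y))) ys
             ≡⟨ sumByℕ-cong ys (λ y → trans (cong indicator (R≡ x y)) (indicator-∧ (P x) (Q y))) ⟩
           sumByℕ (λ y → indicator (P x) * indicator (Q y)) ys ≡⟨ sumByℕ-*ˡ (indicator (P x)) _ ys ⟩
           indicator (P x) * sumByℕ (indicator ∘ Q) ys         ≡⟨ cong (indicator (P x) *_) Q-once ⟩
           indicator (P x) * 1                                ≡⟨ ℕ.*-identityʳ _ ⟩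
           indicator (P x)                                    ∎) ⟩
    sumByℕ (indicator ∘ P) xs ∎
    where open ≡-Reasoning

  sumByℕ-mono-≤ : ∀ {f g : A → ℕ} xs → (∀ x → f x ≤ g x) → sumByℕ f xs ≤ sumByℕ g xs
  sumByℕ-mono-≤ [] _ = ℕ.z≤n
  sumByℕ-mono-≤ (x ∷ xs) f≤g = ℕ.+-mono-≤ (f≤g x) (sumByℕ-mono-≤ xs f≤g)

  sumByℕ-mono-< : ∀ {f g : A → ℕ} {x₀} xs → (∀ x → f x ≤ g x) → x₀ ∈ xs → f x₀ ℕ.< g x₀ →
    sumByℕ f xs ℕ.< sumByℕ g xs
  sumByℕ-mono-< (x ∷ xs) f≤g (here refl) f<g = ℕ.+-mono-<-≤ f<g (sumByℕ-mono-≤ xs f≤g)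
  sumByℕ-mono-< (x ∷ xs) f≤g (there x₀∈) f<g = ℕ.+-mono-≤-< (f≤g x) (sumByℕ-mono-< xs f≤g x₀∈ f<g)

  indicator-mono : ∀ {a b} → (T a → T b) → indicator a ≤ indicator b
  indicator-mono {false} _ = ℕ.z≤n
  indicator-mono {true} a⇒b rewrite Equivalence.to T-≡ (a⇒b _) = ℕ.≤-refl

  indicator-< : ∀ {a b} → ¬ T a → T b → indicator a ℕ.< indicator b
  indicator-< {false} {true} _ _ = ℕ.s≤s ℕ.z≤n
  indicator-< {true} ¬a _ = ⊥-elim (¬a _)

  ≤-sumByℕ : ∀ (f : A → ℕ) {x} xs → x ∈ xs → f x ≤ sumByℕ f xs
  ≤-sumByℕ f (y ∷ xs) (here refl) = ℕ.m≤m+n (f y) _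
  ≤-sumByℕ f (y ∷ xs) (there x∈) = ℕ.≤-trans (≤-sumByℕ f xs x∈) (ℕ.m≤n+m _ (f y))

module Rank {n m : ℕ} (vec : Fin m → Fin n → ℤ) where

  open import Data.Nat as ℕ using (ℕ; suc; _≤_; _≡ᵇ_)
  open import Data.Integer as ℤ using (ℤ; 0ℤ; 1ℤ; -_; _-_; _+_; _*_)
  open import Data.Fin using (Fin)
  import Data.Nat.Properties as ℕ
  import Data.Integer.Properties as ℤ
  open import Data.Integer.Tactic.RingSolver using (solve-∀)
  import Data.Fin.Properties as Fin
  open import Function using (id)
  open import Data.List using (List; []; _∷_; map; length; concatMap; allFin)
  import Data.List.Properties as List
  open import Data.List.Membership.Propositional using (_∈_; find)
  open import Data.List.Membership.Propositional.Properties using (∈-map⁺; ∈-map⁻; ∈-concatMap⁺; ∈-concatMap⁻; ∈-allFin)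
  open import Data.List.Membership.DecPropositional (Fin._≟_ {n}) using () renaming (_∈?_ to _∈ᶜ?_)
  open import Data.List.Membership.DecPropositional (Fin._≟_ {m}) using () renaming (_∈?_ to _∈ʳ?_)
  import Data.List.Relation.Unary.Any as Any
  open import Data.List.Relation.Unary.Any using (here; there)
  open import Data.Bool using (true; false; T; _∧_; if_then_else_)
  open import Data.Product using (_×_; _,_)
  open import Data.Maybe using (Maybe; just; nothing)
  open import Data.Sum using (_⊎_; inj₁; inj₂)
  open import Data.Empty using (⊥-elim)
  open import Relation.Nullary using (yes; no)
  open import Relation.Nullary.Decidable using (toWitnessFalse; fromWitnessFalse)
  open import Relation.Binary.PropositionalEquality
  open import Defs using (rank; sublists; maxℕ; det; nonzeroℤ; dropAt)
  open Sums
  open Determinant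
  open Sublists

  rk : List (Fin m) → ℕ
  rk S = rank n (map vec S)

  Δ : List (Fin m) → List (Fin n) → ℤ
  Δ = minor vec

  Columns : List (List (Fin n))
  Columns = sublists (allFin n)

  maxℕ-ub : ∀ {x xs} → x ∈ xs → x ≤ maxℕ xs
  maxℕ-ub {xs = y ∷ xs} (here refl) = ℕ.m≤m⊔n y (maxℕ xs)
  maxℕ-ub {xs = y ∷ xs} (there x∈) = ℕ.≤-trans (maxℕ-ub x∈) (ℕ.m≤n⊔m y (maxℕ xs))

  maxℕ-∈ : ∀ xs → maxℕ xs ≡ 0 ⊎ maxℕ xs ∈ xs
  maxℕ-∈ [] = inj₁ refl
  maxℕ-∈ (y ∷ xs) with ℕ.⊔-sel y (maxℕ xs)
  ... | inj₁ y⊔≡y = inj₂ (here y⊔≡y)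
  ... | inj₂ y⊔≡max with maxℕ-∈ xs
  ...   | inj₁ max≡0 = inj₁ (trans y⊔≡max max≡0)
  ...   | inj₂ max∈ = inj₂ (there (subst (_∈ xs) (sym y⊔≡max) max∈))

  candidate : List (Fin n → ℤ) → List (Fin n) → ℕ
  candidate R C = if (length R ≡ᵇ length C) ∧ nonzeroℤ (det (map (λ v → map v C) R)) then length R else 0

  candidates : List (Fin n → ℤ) → List ℕ
  candidates M = concatMap (λ R → map (candidate R) Columns) (sublists M)

  det≡Δ : ∀ R C → det (map (λ v → map v C) (map vec R)) ≡ Δ R C
  det≡Δ R C = begin
    det (map (λ v → map v C) (map vec R))   ≡⟨ det≡minor (map vec R) C ⟩
    minor (λ v c → v c) (map vec R) C      ≡⟨ cong (minor (λ v c → v c) (map vec R)) (List.map-id C) ⟨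
    minor (λ v c → v c) (map vec R) (map id C) ≡⟨ minor-map (λ v c → v c) vec id R C ⟩
    Δ R C                                   ∎
    where open ≡-Reasoning

  candidate-view : ∀ R C → candidate R C ≡ 0 ⊎
    (length R ≡ length C × det (map (λ v → map v C) R) ≢ 0ℤ × candidate R C ≡ length R)
  candidate-view R C with (length R ≡ᵇ length C) in e₁ | nonzeroℤ (det (map (λ v → map v C) R)) in e₂
  ... | false | _ = inj₁ refl
  ... | true | false = inj₁ refl
  ... | true | true = inj₂ (ℕ.≡ᵇ⇒≡ _ _ (subst T (sym e₁) _) , toWitnessFalse (subst T (sym e₂) _) , refl)

  candidate-nonzero : ∀ R C → length R ≡ length C → Δ R C ≢ 0ℤ → candidate (map vec R) C ≡ length R
  candidate-nonzero R C len Δ≢0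
    with (length (map vec R) ≡ᵇ length C) in e₁ | nonzeroℤ (det (map (λ v → map v C) (map vec R))) in e₂
  ... | true | true = List.length-map vec R
  ... | false | _ = ⊥-elim (subst T e₁ (ℕ.≡⇒≡ᵇ _ _ (trans (List.length-map vec R) len)))
  ... | true | false = ⊥-elim (subst T e₂ (fromWitnessFalse (λ det≡0 → Δ≢0 (trans (sym (det≡Δ R C)) det≡0))))

  rank-≥ : ∀ S {R C} → R ∈ sublists S → C ∈ Columns → length R ≡ length C → Δ R C ≢ 0ℤ → length R ≤ rk S
  rank-≥ S {R} {C} R∈ C∈ len Δ≢0 = subst (_≤ rk S) (candidate-nonzero R C len Δ≢0)
    (maxℕ-ub (∈-concatMap⁺ (λ R′ → map (candidate R′) Columns)
      (Any.map (λ { refl → ∈-map⁺ (candidate (map vec R)) C∈ }) (∈-sublists-map⁺ vec S R∈))))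

  record MaximalMinor (S : List (Fin m)) : Set where
    field
      rows : List (Fin m)
      cols : List (Fin n)
      rows∈ : rows ∈ sublists S
      cols∈ : cols ∈ Columns
      square : length rows ≡ length cols
      nonzero : Δ rows cols ≢ 0ℤ
      maximal : length rows ≡ rk S

  emptyMinor : ∀ {S} → rk S ≡ 0 → MaximalMinor S
  emptyMinor {S} rk≡0 = record
    { rows = [] ; cols = [] ; rows∈ = []∈sublists S ; cols∈ = []∈sublists (allFin n)
    ; square = refl ; nonzero = λ () ; maximal = sym rk≡0 }

  maximalMinor : ∀ S → MaximalMinor S
  maximalMinor S with maxℕ-∈ (candidates (map vec S))
  ... | inj₁ rk≡0 = emptyMinor rk≡0
  ... | inj₂ rk∈ with find (∈-concatMap⁻ (λ R′ → map (candidate R′) Columns) {xs = sublists (map vec S)} rk∈)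
  ... | R′ , R′∈ , rk∈′ with ∈-map⁻ (candidate R′) rk∈′
  ... | C , C∈ , rk≡ with candidate-view R′ C | ∈-sublists-map⁻ vec S R′∈
  ... | inj₁ cand≡0 | _ = emptyMinor (trans rk≡ cand≡0)
  ... | inj₂ (len , det≢0 , cand≡) | R , R∈ , refl = record
    { rows = R ; cols = C ; rows∈ = R∈ ; cols∈ = C∈
    ; square = trans (sym (List.length-map vec R)) len
    ; nonzero = λ Δ≡0 → det≢0 (trans (det≡Δ R C) Δ≡0)
    ; maximal = trans (sym (List.length-map vec R)) (sym (trans rk≡ cand≡)) }

  rk≤length : ∀ S → rk S ≤ length S
  rk≤length S = subst (_≤ length S) maximal (∈-sublists⇒length≤ S rows∈)
    where open MaximalMinor (maximalMinor S)

  border-vanishes : ∀ S {R C} → R ∈ sublists S → C ∈ Columns → length R ≡ suc (length C) →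
    rk S ≤ length C → ∀ c → Δ R (c ∷ C) ≡ 0ℤ
  border-vanishes S {R} {C} R∈ C∈ len rk≤ c with c ∈ᶜ? C
  ... | yes c∈C = minor-∷-∈ᶜ vec R c C len c∈C
  ... | no c∉C with ∈-sublists-insert (allFin n) C∈ (∈-allFin c) c∉C
  ... | C′ , t , C′∈ , t< , e = begin
    Δ R (c ∷ C)               ≡⟨ cong (Δ R) e ⟨
    Δ R (bringToFront t C′)   ≡⟨ minor-bringToFrontᶜ vec t R C′ len′ t< ⟩
    sign t * Δ R C′           ≡⟨ cong (sign t *_) Δ≡0 ⟩
    sign t * 0ℤ               ≡⟨ ℤ.*-zeroʳ (sign t) ⟩
    0ℤ                        ∎
    where
    open ≡-Reasoning
    len′ : length R ≡ length C′
    len′ = trans len (trans (cong length (sym e)) (length-bringToFront t C′))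
    Δ≡0 : Δ R C′ ≡ 0ℤ
    Δ≡0 with Δ R C′ ℤ.≟ 0ℤ
    ... | yes Δ≡0 = Δ≡0
    ... | no Δ≢0 = ⊥-elim (ℕ.n≮n (length C) (subst (_≤ length C) len (ℕ.≤-trans (rank-≥ S R∈ C′∈ len′ Δ≢0) rk≤)))

  module _ {S} (mm : MaximalMinor S) where
    open MaximalMinor mm

    border-vanishes-∷ : ∀ s → rk (s ∷ S) ≤ rk S → ∀ c → Δ (s ∷ rows) (c ∷ cols) ≡ 0ℤ
    border-vanishes-∷ s rk≤ = border-vanishes (s ∷ S) (∈-sublists-keep s S rows∈) cols∈ (cong suc square)
      (subst (rk (s ∷ S) ≤_) (trans (sym maximal) square) rk≤)

    border-vanishes-∈ : ∀ {s} → s ∈ S → ∀ c → Δ (s ∷ rows) (c ∷ cols) ≡ 0ℤ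
    border-vanishes-∈ {s} s∈S c with s ∈ʳ? rows
    ... | yes s∈rows = minor-∷-∈ vec s rows (c ∷ cols) s∈rows
    ... | no s∉rows with ∈-sublists-insert S rows∈ s∈S s∉rows
    ... | R₁ , u , R₁∈ , u< , e = begin
      Δ (s ∷ rows) (c ∷ cols)            ≡⟨ cong (λ R → Δ R (c ∷ cols)) e ⟨
      Δ (bringToFront u R₁) (c ∷ cols)   ≡⟨ minor-bringToFront vec u R₁ (c ∷ cols) u< ⟩
      sign u * Δ R₁ (c ∷ cols)           ≡⟨ cong (sign u *_) (border-vanishes S R₁∈ cols∈ len₁ (ℕ.≤-reflexive (trans (sym maximal) square)) c) ⟩
      sign u * 0ℤ                        ≡⟨ ℤ.*-zeroʳ (sign u) ⟩
      0ℤ                                 ∎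
      where
      open ≡-Reasoning
      len₁ : length R₁ ≡ suc (length cols)
      len₁ = trans (sym (length-bringToFront u R₁)) (trans (cong length e) (cong suc square))

  -- Expanding the vanishing bordered minors along their first column expresses
  -- Δ R C · vec s as a combination of the rows vec r, r ∈ R.
  dependence : ∀ s R C → length R ≡ length C → (∀ c → Δ (s ∷ R) (c ∷ C) ≡ 0ℤ) →
    ∀ c → vec s c * Δ R C ≡ isum (λ i r → sign i * vec r c * Δ (s ∷ dropAt i R) C) R
  dependence s R C len vanish c = ℤ.i-j≡0⇒i≡j _ _ (begin
    vec s c * Δ R C - isum (λ i r → sign i * vec r c * Δ (s ∷ dropAt i R) C) R
      ≡⟨ cong₂ _+_ (sym (trans (ℤ.*-assoc 1ℤ (vec s c) _) (ℤ.*-identityˡ _)))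
                   (trans (sym (isum-neg _ R)) (isum-cong R (λ i r → negate (sign i) (vec r c) _))) ⟩
    1ℤ * vec s c * Δ R C + isum (λ i r → - sign i * vec r c * Δ (s ∷ dropAt i R) C) R
      ≡⟨ minor-firstColumn vec (s ∷ R) c C (cong suc len) ⟨
    Δ (s ∷ R) (c ∷ C)
      ≡⟨ vanish c ⟩
    0ℤ ∎)
    where
    open ≡-Reasoning
    negate : ∀ x y z → - (x * y * z) ≡ - x * y * z
    negate = solve-∀

  dependence-dot : ∀ s R C → length R ≡ length C → (∀ c → Δ (s ∷ R) (c ∷ C) ≡ 0ℤ) →
    ∀ w → Δ R C * dot (vec s) w ≡ isum (λ i r → sign i * Δ (s ∷ dropAt i R) C * dot (vec r) w) R
  dependence-dot s R C len vanish w = begin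
    Δ R C * dot (vec s) w
      ≡⟨ isum-*ˡ (Δ R C) _ (allFin n) ⟨
    sumBy (λ c → Δ R C * (vec s c * w c)) (allFin n)
      ≡⟨ isum-cong (allFin n) (λ _ c → trans (rearrange (Δ R C) (vec s c) (w c))
                                             (cong (_* w c) (dependence s R C len vanish c))) ⟩
    sumBy (λ c → isum (λ i r → sign i * vec r c * K i) R * w c) (allFin n)
      ≡⟨ isum-cong (allFin n) (λ _ c → sym (isum-*ʳ (w c) _ R)) ⟩
    sumBy (λ c → isum (λ i r → sign i * vec r c * K i * w c) R) (allFin n)
      ≡⟨ isum-swap _ (allFin n) R ⟩
    isum (λ i r → sumBy (λ c → sign i * vec r c * K i * w c) (allFin n)) R
      ≡⟨ isum-cong R (λ i r → trans (isum-cong (allFin n) (λ _ c → rearrange₂ (sign i) (vec r c) (K i) (w c)))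
                                    (isum-*ˡ (sign i * K i) _ (allFin n))) ⟩
    isum (λ i r → sign i * K i * dot (vec r) w) R ∎
    where
    open ≡-Reasoning
    K : ℕ → ℤ
    K i = Δ (s ∷ dropAt i R) C
    rearrange : ∀ d x y → d * (x * y) ≡ x * d * y
    rearrange = solve-∀
    rearrange₂ : ∀ s x k y → s * x * k * y ≡ s * k * (x * y)
    rearrange₂ = solve-∀

  module Cramer {L : Set} (row : L → Fin m) (rhs : L → ℤ) where

    -- Column nothing holds the right-hand sides, column just c the entries of vec.
    augmented : L → Maybe (Fin n) → ℤ
    augmented l nothing = rhs l
    augmented l (just c) = vec (row l) c

    cofactor : List L → List (Fin n) → ℕ → ℤ
    cofactor E C j = minor augmented E (nothing ∷ map just (dropAt j C))

    solution : List L → List (Fin n) → Fin n → ℤ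
    solution E C c′ = isum (λ j c → sign j * cofactor E C j * δ c c′) C

    augmented-columns : ∀ E C → minor augmented E (map just C) ≡ Δ (map row E) C
    augmented-columns E C = begin
      minor augmented E (map just C)            ≡⟨ cong (λ l → minor augmented l (map just C)) (List.map-id E) ⟨
      minor augmented (map id E) (map just C)   ≡⟨ minor-map augmented id just E C ⟩
      minor (λ l c → vec (row l) c) E C         ≡⟨ minor-map vec row id E C ⟨
      minor vec (map row E) (map id C)          ≡⟨ cong (minor vec (map row E)) (List.map-id C) ⟩
      Δ (map row E) C                           ∎
      where open ≡-Reasoning

    -- The augmented minor with a repeated row l vanishes; expanding it along
    -- that row is Cramer's rule.
    solution-solves : ∀ E C {l} → l ∈ E → dot (vec (row l)) (solution E C) ≡ rhs l * Δ (map row E) C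
    solution-solves E C {l} l∈E = begin
      dot (vec (row l)) (solution E C)
        ≡⟨ isum-cong (allFin n) (λ _ c′ → sym (isum-*ˡ (vec (row l) c′) _ C)) ⟩
      sumBy (λ c′ → isum (λ j c → vec (row l) c′ * (sign j * cofactor E C j * δ c c′)) C) (allFin n)
        ≡⟨ isum-swap _ (allFin n) C ⟩
      isum (λ j c → sumBy (λ c′ → vec (row l) c′ * (sign j * cofactor E C j * δ c c′)) (allFin n)) C
        ≡⟨ isum-cong C (λ j c → let a = sign j * cofactor E C j in
             trans (isum-cong (allFin n) (λ _ c′ → commute (vec (row l) c′) a (δ c c′)))
                   (trans (isum-*ˡ a _ (allFin n)) (cong (a *_) (dot-δʳ (vec (row l)) c)))) ⟩
      isum (λ j c → sign j * cofactor E C j * vec (row l) c) C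
        ≡⟨ isum-cong C (λ j c → swap (sign j) (cofactor E C j) (vec (row l) c)) ⟩
      isum (λ j c → sign j * vec (row l) c * cofactor E C j) C
        ≡⟨ ℤ.i-j≡0⇒i≡j _ _ repeated-row-expansion ⟨
      rhs l * Δ (map row E) C ∎
      where
      open ≡-Reasoning
      commute : ∀ h a d → h * (a * d) ≡ a * (h * d)
      commute = solve-∀
      swap : ∀ s a v → s * a * v ≡ s * v * a
      swap = solve-∀
      Φ : List (Maybe (Fin n)) → ℤ
      Φ = minor augmented E
      repeated-row-expansion : rhs l * Δ (map row E) C - isum (λ j c → sign j * vec (row l) c * cofactor E C j) C ≡ 0ℤ
      repeated-row-expansion = begin
        rhs l * Δ (map row E) C - isum (λ j c → sign j * vec (row l) c * cofactor E C j) C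
          ≡⟨ cong₂ (λ x y → rhs l * x - y) (augmented-columns E C)
               (trans (isum-map _ just C)
                      (isum-cong C (λ j c → cong (λ l′ → sign j * vec (row l) c * Φ (nothing ∷ l′)) (dropAt-map just j C)))) ⟨
        rhs l * Φ (map just C) - expand (augmented l) (λ l′ → Φ (nothing ∷ l′)) (map just C)
          ≡⟨ expand-∷ (augmented l) Φ nothing (map just C) ⟨
        minor augmented (l ∷ E) (nothing ∷ map just C)
          ≡⟨ minor-∷-∈ augmented l E (nothing ∷ map just C) l∈E ⟩
        0ℤ ∎

module Fibres (p : ℕ) .{{_ : NonZero p}} where

  open import Data.Nat as ℕ using (ℕ; zero; suc; _^_; _∸_; _≤_; NonZero)
  open import Function using (_∘_; id)
  import Data.Nat.Properties as ℕ
  import Data.Nat.Divisibility as ℕ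
  open import Data.Integer as ℤ using (ℤ; +_; 0ℤ; -_; _-_; _+_; _*_; ∣_∣)
  import Data.Integer.Properties as ℤ
  open import Data.Integer.Tactic.RingSolver using (solve-∀)
  open import Data.Integer.Divisibility.Signed using (_∣_; ∣ᵤ⇒∣; ∣⇒∣ᵤ)
  open import Data.Fin as Fin using (Fin; toℕ)
  import Data.Fin.Properties as Fin
  import Data.Fin.Permutation as Perm
  open import Data.List using (List; []; _∷_; map; length; allFin)
  import Data.List.Properties as List
  open import Data.List.Membership.Propositional using (_∈_)
  open import Data.List.Membership.Propositional.Properties using (∈-allFin; ∈-map⁺)
  open import Data.List.Relation.Unary.Any using (here; there)
  open import Data.Vec as Vec using (Vec)
  import Data.Vec.Properties as Vec
  open import Data.Bool using (Bool; true; T; _∧_)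
  open import Data.Bool.Properties using (T-∧)
  open import Data.Bool.ListAction using (all)
  open import Data.Product as Product using (∃; _,_)
  open import Function.Bundles using (Equivalence)
  open import Relation.Nullary.Decidable using (⌊_⌋; toWitness; fromWitness)
  open import Relation.Binary.PropositionalEquality
  open import Algebra.Properties.CommutativeMonoid.Sum ℕ.+-0-commutativeMonoid using (sum; sum-permute; sum-cong-≗)
  open import Defs using (allVecs; listsOfLength; eqF)
  open Sums
  open Congruence
  open Counting
  open Booleans
  open Sublists using (indexed)
  open Mod p

  _+ₚ_ : Fin p → Fin p → Fin p
  x +ₚ y = reduce (+ toℕ x + + toℕ y)

  _-ₚ_ : Fin p → Fin p → Fin p
  x -ₚ y = reduce (+ toℕ x - + toℕ y)

  -ₚ-+ₚ : ∀ t x → (x +ₚ t) -ₚ t ≡ x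
  -ₚ-+ₚ t x = toℕ-≈⇒≡ ((x +ₚ t) -ₚ t) x (begin
    + toℕ ((x +ₚ t) -ₚ t)             ≈⟨ reduce-≈ _ ⟩
    + toℕ (x +ₚ t) - + toℕ t          ≈⟨ +-congʳ-≈ (- + toℕ t) (reduce-≈ (+ toℕ x + + toℕ t)) ⟩
    + toℕ x + + toℕ t - + toℕ t       ≡⟨ cancel (+ toℕ x) (+ toℕ t) ⟩
    + toℕ x                           ∎)
    where
    open ≈-Reasoning
    cancel : ∀ a b → a + b - b ≡ a
    cancel = solve-∀

  +ₚ--ₚ : ∀ t y → (y -ₚ t) +ₚ t ≡ y
  +ₚ--ₚ t y = toℕ-≈⇒≡ ((y -ₚ t) +ₚ t) y (begin
    + toℕ ((y -ₚ t) +ₚ t)             ≈⟨ reduce-≈ _ ⟩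
    + toℕ (y -ₚ t) + + toℕ t          ≈⟨ +-congʳ-≈ (+ toℕ t) (reduce-≈ (+ toℕ y - + toℕ t)) ⟩
    + toℕ y - + toℕ t + + toℕ t       ≡⟨ cancel (+ toℕ y) (+ toℕ t) ⟩
    + toℕ y                           ∎)
    where
    open ≈-Reasoning
    cancel : ∀ a b → a - b + b ≡ a
    cancel = solve-∀

  allFin-translationInvariant : TranslationInvariant (allFin p) _+ₚ_
  allFin-translationInvariant h t = begin
    sumByℕ (λ x → h (x +ₚ t)) (allFin p)   ≡⟨ sumByℕ-allFin p _ ⟩
    sum (λ x → h (x +ₚ t))                 ≡⟨ sum-permute h (Perm.permutation (_+ₚ t) (_-ₚ t) (+ₚ--ₚ t) (-ₚ-+ₚ t)) ⟨
    sum h                                  ≡⟨ sumByℕ-allFin p h ⟨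
    sumByℕ h (allFin p)                    ∎
    where open ≡-Reasoning

  divisibleᵇ : ℤ → Bool
  divisibleᵇ z = ⌊ p ℕ.∣? ∣ z ∣ ⌋

  divisibleᵇ⁺ : ∀ {z} → + p ∣ z → T (divisibleᵇ z)
  divisibleᵇ⁺ p∣z = fromWitness (∣⇒∣ᵤ p∣z)

  divisibleᵇ⁻ : ∀ {z} → T (divisibleᵇ z) → + p ∣ z
  divisibleᵇ⁻ t = ∣ᵤ⇒∣ (toWitness t)

  divisibleᵇ-cong : ∀ {a b} → a ≈ b → divisibleᵇ a ≡ divisibleᵇ b
  divisibleᵇ-cong a≈b = T⇔⇒≡ (divisibleᵇ⁺ ∘ ∣-resp-≈ a≈b ∘ divisibleᵇ⁻) (divisibleᵇ⁺ ∘ ∣-resp-≈ (≈-sym a≈b) ∘ divisibleᵇ⁻)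

  indicator-eqF-sum : ∀ {n} (x₀ : Fin n) → sum (λ x → indicator (eqF x x₀)) ≡ 1
  indicator-eqF-sum {suc n} Fin.zero = cong suc (zeros n)
    where
    zeros : ∀ m → sum {m} (λ x → indicator (eqF (Fin.suc x) (Fin.zero {m}))) ≡ 0
    zeros zero = refl
    zeros (suc m) = zeros m
  indicator-eqF-sum {suc n} (Fin.suc x₀) =
    trans (sum-cong-≗ (λ x → cong indicator (eqF-suc x x₀))) (indicator-eqF-sum x₀)

  unique-residue : ∀ z → sumByℕ (λ x → indicator (divisibleᵇ (z - + toℕ x))) (allFin p) ≡ 1
  unique-residue z = trans (sumByℕ-cong (allFin p) (λ x → cong indicator (T⇔⇒≡ (to x) (from x))))
                           (trans (sumByℕ-allFin p _) (indicator-eqF-sum (reduce z)))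
    where
    to : ∀ x → T (divisibleᵇ (z - + toℕ x)) → T (eqF x (reduce z))
    to x t = fromWitness (trans (sym (reduce-toℕ x)) (reduce-cong (≈-sym (mod {z} {+ toℕ x} (divisibleᵇ⁻ t)))))
    from : ∀ x → T (eqF x (reduce z)) → T (divisibleᵇ (z - + toℕ x))
    from x t rewrite toWitness t = divisibleᵇ⁺ (∣-diff (≈-sym (reduce-≈ z)))

  all-allFin-suc : ∀ {ℓ} (P : Fin (suc ℓ) → Bool) → all P (allFin (suc ℓ)) ≡ P Fin.zero ∧ all (P ∘ Fin.suc) (allFin ℓ)
  all-allFin-suc {ℓ} P = cong (λ l → P Fin.zero ∧ Data.Bool.ListAction.and l)
    (trans (List.map-tabulate Fin.suc P) (sym (List.map-tabulate id (P ∘ Fin.suc))))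

  unique-residues : ∀ ℓ (z : Fin ℓ → ℤ) →
    sumByℕ (λ y → indicator (all (λ j → divisibleᵇ (z j - + toℕ (Vec.lookup y j))) (allFin ℓ))) (allVecs ℓ (allFin p)) ≡ 1
  unique-residues zero z = refl
  unique-residues (suc ℓ) z = trans
    (count-product Vec._∷_ (λ x → divisibleᵇ (z Fin.zero - + toℕ x))
      (λ y → all (λ j → divisibleᵇ (z (Fin.suc j) - + toℕ (Vec.lookup y j))) (allFin ℓ)) _
      (allFin p) (allVecs ℓ (allFin p)) (λ x y → all-allFin-suc (λ j → divisibleᵇ (z j - + toℕ (Vec.lookup (x Vec.∷ y) j))))
      (unique-residues ℓ (z ∘ Fin.suc)))
    (unique-residue (z Fin.zero))

  module Systems (k n : ℕ) where

    Weight : Set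
    Weight = Vec (Vec (Fin p) k) n

    weights : List Weight
    weights = allVecs n (allVecs k (allFin p))

    _⊕_ : Weight → Weight → Weight
    _⊕_ = Vec.zipWith (Vec.zipWith _+ₚ_)

    weights-translationInvariant : TranslationInvariant weights _⊕_
    weights-translationInvariant = allVecs-translationInvariant (allVecs-translationInvariant allFin-translationInvariant k) n

    length-weights : length weights ≡ (p ^ k) ^ n
    length-weights = trans (length-allVecs n _) (cong (_^ n) (trans (length-allVecs k (allFin p)) (cong (_^ k) (List.length-tabulate id))))

    coordinate : Weight → Fin k → Fin n → ℤ
    coordinate W j c = + toℕ (Vec.lookup (Vec.lookup W c) j)

    coordinate-⊕ : ∀ W U j c → coordinate (W ⊕ U) j c ≈ coordinate W j c + coordinate U j c
    coordinate-⊕ W U j c rewrite Vec.lookup-zipWith (Vec.zipWith _+ₚ_) c W U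
                               | Vec.lookup-zipWith _+ₚ_ j (Vec.lookup W c) (Vec.lookup U c) = reduce-≈ _

    dot-⊕ : ∀ ρ W U j → dot ρ (coordinate (W ⊕ U) j) ≈ dot ρ (coordinate W j) + dot ρ (coordinate U j)
    dot-⊕ ρ W U j = ≈-trans (dot-congʳ-≈ ρ (coordinate-⊕ W U j))
                            (≈-reflexive (dot-+ʳ ρ (coordinate W j) (coordinate U j)))

    annihilatesᵇ : (Fin n → ℤ) → Weight → Bool
    annihilatesᵇ ρ W = all (λ j → divisibleᵇ (dot ρ (coordinate W j))) (allFin k)

    Annihilatesᵇ : List (Fin n → ℤ) → Weight → Bool
    Annihilatesᵇ ρs W = all (λ ρ → annihilatesᵇ ρ W) ρs

    solvesᵇ : (Fin n → ℤ) → (Fin k → ℤ) → Weight → Bool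
    solvesᵇ ρ b W = all (λ j → divisibleᵇ (dot ρ (coordinate W j) - b j)) (allFin k)

    Solvesᵇ : List (Fin n → ℤ) → (ℕ → Fin k → ℤ) → Weight → Bool
    Solvesᵇ [] β W = true
    Solvesᵇ (ρ ∷ ρs) β W = solvesᵇ ρ (β 0) W ∧ Solvesᵇ ρs (β ∘ suc) W

    residues : Vec (Fin p) k → Fin k → ℤ
    residues y j = + toℕ (Vec.lookup y j)

    -- Junk value 0 past the end of the list.
    target : List (Vec (Fin p) k) → ℕ → Fin k → ℤ
    target [] i j = 0ℤ
    target (y ∷ ys) zero = residues y
    target (y ∷ ys) (suc i) = target ys i

    targets : ℕ → List (List (Vec (Fin p) k))
    targets r = listsOfLength r (allVecs k (allFin p))

    length-targets : ∀ r → length (targets r) ≡ (p ^ k) ^ r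
    length-targets r = trans (length-listsOfLength r _) (cong (_^ r) (trans (length-allVecs k (allFin p)) (cong (_^ k) (List.length-tabulate id))))

    unique-target : ∀ ρs W → sumByℕ (λ ys → indicator (Solvesᵇ ρs (target ys) W)) (targets (length ρs)) ≡ 1
    unique-target [] W = refl
    unique-target (ρ ∷ ρs) W = trans
      (count-product _∷_ (λ y → solvesᵇ ρ (residues y) W) (λ ys → Solvesᵇ ρs (target ys) W) _
        (allVecs k (allFin p)) (targets (length ρs)) (λ _ _ → refl) (unique-target ρs W))
      (unique-residues k (λ j → dot ρ (coordinate W j)))

    solvesᵇ-shift : ∀ ρ b U W → T (solvesᵇ ρ b U) → solvesᵇ ρ b (W ⊕ U) ≡ annihilatesᵇ ρ W
    solvesᵇ-shift ρ b U W t = all-cong (allFin k) (λ j → divisibleᵇ-cong (begin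
      dot ρ (coordinate (W ⊕ U) j) - b j                           ≈⟨ +-congʳ-≈ (- b j) (dot-⊕ ρ W U j) ⟩
      dot ρ (coordinate W j) + dot ρ (coordinate U j) - b j        ≡⟨ ℤ.+-assoc (dot ρ (coordinate W j)) _ _ ⟩
      dot ρ (coordinate W j) + (dot ρ (coordinate U j) - b j)
        ≈⟨ +-congˡ-≈ (dot ρ (coordinate W j)) (∣⇒≈0 {dot ρ (coordinate U j) - b j} (divisibleᵇ⁻ (T-all⁻ _ (allFin k) t (∈-allFin j)))) ⟩
      dot ρ (coordinate W j) + 0ℤ                                  ≡⟨ ℤ.+-identityʳ _ ⟩
      dot ρ (coordinate W j)                                       ∎))
      where open ≈-Reasoning

    Solvesᵇ-shift : ∀ ρs β U W → T (Solvesᵇ ρs β U) → Solvesᵇ ρs β (W ⊕ U) ≡ Annihilatesᵇ ρs W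
    Solvesᵇ-shift [] β U W _ = refl
    Solvesᵇ-shift (ρ ∷ ρs) β U W t with Equivalence.to T-∧ t
    ... | t₁ , t₂ = cong₂ _∧_ (solvesᵇ-shift ρ (β 0) U W t₁) (Solvesᵇ-shift ρs (β ∘ suc) U W t₂)

    -- If every right-hand side is attained, all fibres of W ↦ (ρ · W)_{ρ ∈ ρs} are
    -- translates of the kernel, and they partition the (p^k)^n weights.
    kernel-size : ∀ ρs → (∀ ys → ∃ λ U → T (Solvesᵇ ρs (target ys) U)) → length ρs ≤ n →
      sumByℕ (indicator ∘ Annihilatesᵇ ρs) weights ≡ (p ^ k) ^ (n ∸ length ρs)
    kernel-size ρs solvable r≤n = ℕ.*-cancelˡ-≡ K ((p ^ k) ^ (n ∸ r)) ((p ^ k) ^ r) {{ℕ.m^n≢0 (p ^ k) r {{ℕ.m^n≢0 p k}}}} (begin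
      (p ^ k) ^ r ℕ.* K
        ≡⟨ cong (ℕ._* K) (length-targets r) ⟨
      length (targets r) ℕ.* K
        ≡⟨ sumByℕ-const K (targets r) ⟨
      sumByℕ (λ _ → K) (targets r)
        ≡⟨ sumByℕ-cong (targets r) (λ ys → sym (fibre-size ys)) ⟩
      sumByℕ (λ ys → sumByℕ (λ W → indicator (Solvesᵇ ρs (target ys) W)) weights) (targets r)
        ≡⟨ sumByℕ-swap (λ W ys → indicator (Solvesᵇ ρs (target ys) W)) weights (targets r) ⟨
      sumByℕ (λ W → sumByℕ (λ ys → indicator (Solvesᵇ ρs (target ys) W)) (targets r)) weights
        ≡⟨ sumByℕ-cong weights (unique-target ρs) ⟩
      sumByℕ (λ _ → 1) weights
        ≡⟨ length≡sumByℕ weights ⟨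
      length weights
        ≡⟨ length-weights ⟩
      (p ^ k) ^ n
        ≡⟨ cong ((p ^ k) ^_) (ℕ.m+[n∸m]≡n r≤n) ⟨
      (p ^ k) ^ (r ℕ.+ (n ∸ r))
        ≡⟨ ℕ.^-distribˡ-+-* (p ^ k) r (n ∸ r) ⟩
      (p ^ k) ^ r ℕ.* (p ^ k) ^ (n ∸ r) ∎)
      where
      open ≡-Reasoning
      r : ℕ
      r = length ρs
      K : ℕ
      K = sumByℕ (indicator ∘ Annihilatesᵇ ρs) weights
      fibre-size : ∀ ys → sumByℕ (λ W → indicator (Solvesᵇ ρs (target ys) W)) weights ≡ K
      fibre-size ys with solvable ys
      ... | U , t = trans (sym (weights-translationInvariant _ U))
                          (sumByℕ-cong weights (λ W → cong indicator (Solvesᵇ-shift ρs (target ys) U W t)))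

    Solvesᵇ-intro : ∀ {A : Set} (f : A → Fin n → ℤ) xs β W →
      (∀ {i x} → (i , x) ∈ indexed xs → T (solvesᵇ (f x) (β i) W)) → T (Solvesᵇ (map f xs) β W)
    Solvesᵇ-intro f [] β W _ = _
    Solvesᵇ-intro f (x ∷ xs) β W solves = Equivalence.from T-∧
      (solves (here refl) , Solvesᵇ-intro f xs (β ∘ suc) W (λ ix∈ → solves (there (∈-map⁺ (Product.map₁ suc) ix∈))))

    annihilatesᵇ⁺ : ∀ ρ W → (∀ j → + p ∣ dot ρ (coordinate W j)) → T (annihilatesᵇ ρ W)
    annihilatesᵇ⁺ ρ W p∣ = T-all⁺ _ (allFin k) (λ {j} _ → divisibleᵇ⁺ (p∣ j))

    annihilatesᵇ⁻ : ∀ ρ W → T (annihilatesᵇ ρ W) → ∀ j → + p ∣ dot ρ (coordinate W j)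
    annihilatesᵇ⁻ ρ W t j = divisibleᵇ⁻ (T-all⁻ _ (allFin k) t (∈-allFin j))

module Möbius (n : ℕ) (H : List (Fin n → ℤ)) where

  open import Data.Nat as ℕ using (ℕ; suc; _<_; _≤_)
  open import Data.Integer as ℤ using (ℤ)
  open import Data.Fin using (Fin)
  open import Data.List using (List)
  open import Function using (_∘_; id)
  import Data.Nat.Properties as ℕ
  open import Data.Integer using (0ℤ; 1ℤ; -_; _+_)
  import Data.Integer.Properties as ℤ
  open import Data.List using ([]; _∷_; map; length; allFin; filterᵇ; null)
  import Data.List.Properties as List
  open import Data.List.Membership.Propositional using (_∈_; find)
  open import Data.List.Membership.Propositional.Properties using (∈-allFin; ∈-filter⁻)
  open import Data.List.Relation.Unary.All.Properties.Core using (¬All⇒Any¬)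
  import Data.List.Relation.Unary.All.Properties as All
  import Data.List.Relation.Unary.Unique.Propositional.Properties as Unique
  open import Data.List.Relation.Unary.Unique.Propositional using (Unique)
  open import Data.Bool using (true; false; T; not; _∧_; if_then_else_)
  open import Data.Bool.Properties using (T-∧; ∧-zeroʳ)
  open import Data.Product using (_,_; proj₁; proj₂)
  open import Data.Empty using (⊥-elim)
  open import Function.Bundles using (Equivalence)
  open import Relation.Nullary.Decidable using (T?)
  open import Relation.Binary.PropositionalEquality
  open import Defs using (module Arrangement; memb; sumℤ; sublists)
  open Arrangement n H
  open Sums
  open Counting
  open Booleans
  open Sublists

  ⊆ᵇ⁻ : ∀ {X Y} → T (⊆ᵇ X Y) → ∀ {x} → x ∈ X → x ∈ Y
  ⊆ᵇ⁻ {X} {Y} t x∈ = T-memb⁻ Y (T-all⁻ (λ x → memb x Y) X t x∈)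

  ⊆ᵇ⁺ : ∀ {X Y} → (∀ {x} → x ∈ X → x ∈ Y) → T (⊆ᵇ X Y)
  ⊆ᵇ⁺ {X} {Y} X⊆Y = T-all⁺ (λ x → memb x Y) X (T-memb⁺ Y ∘ X⊆Y)

  -- The number of hyperplanes in X; it strictly increases along ltᵇ, which
  -- bounds the recursion depth of muFuel.
  size : List (Fin m) → ℕ
  size X = length (filterᵇ (λ x → memb x X) (allFin m))

  size≤m : ∀ X → size X ≤ m
  size≤m X = ℕ.≤-trans (List.length-filter (T? ∘ (λ x → memb x X)) (allFin m)) (ℕ.≤-reflexive (List.length-tabulate id))

  size-< : ∀ X Y → T (ltᵇ X Y) → size X < size Y
  size-< X Y t with Equivalence.to T-∧ t
  ... | X⊆Y , Y⊈X with find (¬All⇒Any¬ (T? ∘ (λ y → memb y X)) Y (T-not⇒¬T Y⊈X ∘ All.all⁻ (λ y → memb y X)))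
  ... | y , y∈Y , y∉X = subst₂ _<_ (sym (length-filterᵇ _ (allFin m))) (sym (length-filterᵇ _ (allFin m)))
    (sumByℕ-mono-< (allFin m) (λ x → indicator-mono (T-memb⁺ Y ∘ ⊆ᵇ⁻ X⊆Y ∘ T-memb⁻ X)) (∈-allFin y)
      (indicator-< y∉X (T-memb⁺ Y y∈Y)))

  below : List (Fin m) → List (List (Fin m))
  below X = filterᵇ (λ Z → leᵇ bottom Z ∧ ltᵇ Z X) flats

  muFuel-stable : ∀ f f′ X → size X < f → size X < f′ → muFuel f X ≡ muFuel f′ X
  muFuel-stable (suc f) (suc f′) X s<f s<f′ with isBottom X
  ... | true = refl
  ... | false = cong -_ (begin
    sumℤ (map (muFuel f) (below X))    ≡⟨ sumℤ-map (muFuel f) (below X) ⟩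
    sumBy (muFuel f) (below X)         ≡⟨ isum-cong-∈ (below X) (λ _ Z Z∈ → muFuel-stable f f′ Z (bound s<f Z∈) (bound s<f′ Z∈)) ⟩
    sumBy (muFuel f′) (below X)        ≡⟨ sumℤ-map (muFuel f′) (below X) ⟨
    sumℤ (map (muFuel f′) (below X))   ∎)
    where
    open ≡-Reasoning
    bound : ∀ {g Z} → size X < suc g → Z ∈ below X → size Z < g
    bound {Z = Z} s< Z∈ = ℕ.<-≤-trans (size-< Z X Z<X) (ℕ.≤-pred s<)
      where
      Z<X : T (ltᵇ Z X)
      Z<X = proj₂ (Equivalence.to (T-∧ {leᵇ bottom Z}) (proj₂ (∈-filter⁻ (T? ∘ (λ Z → leᵇ bottom Z ∧ ltᵇ Z X)) {xs = flats} Z∈)))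

  flats-unique : Unique flats
  flats-unique = Unique.filter⁺ (T? ∘ closedᵇ) (sublists-unique (allFin m) (Unique.allFin⁺ m))

  module _ (bottom≡[] : bottom ≡ []) where

    μ₀-[] : μ₀ [] ≡ 1ℤ
    μ₀-[] rewrite cong (λ b → ⊆ᵇ b []) bottom≡[] = refl

    μ₀-∷ : ∀ y Y → μ₀ (y ∷ Y) ≡ - sumBy (λ Z → if ltᵇ Z (y ∷ Y) then μ₀ Z else 0ℤ) flats
    μ₀-∷ y Y rewrite cong (λ b → ⊆ᵇ (y ∷ Y) b ∧ ⊆ᵇ b (y ∷ Y)) bottom≡[] = cong -_ (begin
      sumℤ (map (muFuel m) (below (y ∷ Y)))
        ≡⟨ sumℤ-map (muFuel m) (below (y ∷ Y)) ⟩
      sumBy (muFuel m) (filterᵇ (λ Z → leᵇ bottom Z ∧ ltᵇ Z (y ∷ Y)) flats)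
        ≡⟨ cong (λ b → sumBy (muFuel m) (filterᵇ (λ Z → leᵇ b Z ∧ ltᵇ Z (y ∷ Y)) flats)) bottom≡[] ⟩
      sumBy (muFuel m) (filterᵇ (λ Z → ltᵇ Z (y ∷ Y)) flats)
        ≡⟨ sumBy-filterᵇ (λ Z → ltᵇ Z (y ∷ Y)) (muFuel m) flats ⟩
      sumBy (λ Z → if ltᵇ Z (y ∷ Y) then muFuel m Z else 0ℤ) flats
        ≡⟨ isum-cong flats (λ _ Z → refuel Z (ltᵇ Z (y ∷ Y)) refl) ⟩
      sumBy (λ Z → if ltᵇ Z (y ∷ Y) then μ₀ Z else 0ℤ) flats ∎)
      where
      open ≡-Reasoning
      refuel : ∀ Z b → ltᵇ Z (y ∷ Y) ≡ b → (if b then muFuel m Z else 0ℤ) ≡ (if b then μ₀ Z else 0ℤ)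
      refuel Z false _ = refl
      refuel Z true Z<Y = muFuel-stable m (suc m) Z (ℕ.<-≤-trans s< (size≤m (y ∷ Y))) (ℕ.m≤n⇒m≤1+n (ℕ.<-≤-trans s< (size≤m (y ∷ Y))))
        where
        s< : size Z < size (y ∷ Y)
        s< = size-< Z (y ∷ Y) (subst T (sym Z<Y) _)

    -- Σ_{X ≤ Y} μ(0̂, X) = [Y = 0̂]: the term X = Y and the defining recursion of μ₀ cancel.
    μ₀-sum : ∀ {Y} → Y ∈ flats → sumBy (λ X → if ⊆ᵇ X Y then μ₀ X else 0ℤ) flats ≡ (if null Y then 1ℤ else 0ℤ)
    μ₀-sum {Y} Y∈ = begin
      sumBy (λ X → if ⊆ᵇ X Y then μ₀ X else 0ℤ) flats
        ≡⟨ isum-cong flats (λ _ X → split (⊆ᵇ X Y) (⊆ᵇ Y X) (μ₀ X)) ⟩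
      sumBy (λ X → equal X + strictlyBelow X) flats
        ≡⟨ isum-+ _ _ flats ⟩
      sumBy equal flats + sumBy strictlyBelow flats
        ≡⟨ cong (_+ sumBy strictlyBelow flats) (sumBy-single flats flats-unique Y∈ unequal) ⟩
      equal Y + sumBy strictlyBelow flats
        ≡⟨ cong (_+ sumBy strictlyBelow flats) equal-self ⟩
      μ₀ Y + sumBy strictlyBelow flats
        ≡⟨ recursion Y ⟩
      (if null Y then 1ℤ else 0ℤ) ∎
      where
      open ≡-Reasoning
      equal strictlyBelow : List (Fin m) → ℤ
      equal X = if ⊆ᵇ X Y ∧ ⊆ᵇ Y X then μ₀ X else 0ℤ
      strictlyBelow X = if ltᵇ X Y then μ₀ X else 0ℤ
      equal-self : equal Y ≡ μ₀ Y
      equal-self = if-T {b = ⊆ᵇ Y Y ∧ ⊆ᵇ Y Y} {x = μ₀ Y} {y = 0ℤ}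
                     (Equivalence.from (T-∧ {⊆ᵇ Y Y}) (⊆ᵇ⁺ {Y} {Y} id , ⊆ᵇ⁺ {Y} {Y} id))
      split : ∀ a b (v : ℤ) → (if a then v else 0ℤ) ≡ (if a ∧ b then v else 0ℤ) + (if a ∧ not b then v else 0ℤ)
      split true true v = sym (ℤ.+-identityʳ v)
      split true false v = sym (ℤ.+-identityˡ v)
      split false b v = refl
      sublist : ∀ {X} → X ∈ flats → X ∈ sublists (allFin m)
      sublist X∈ = proj₁ (∈-filter⁻ (T? ∘ closedᵇ) X∈)
      unequal : ∀ {X} → X ∈ flats → X ≢ Y → equal X ≡ 0ℤ
      unequal {X} X∈ X≢Y with ⊆ᵇ X Y in X⊆Y | ⊆ᵇ Y X in Y⊆X
      ... | true | true = ⊥-elim (X≢Y (∈-sublists-unique (allFin m) (Unique.allFin⁺ m) (sublist X∈) (sublist Y∈)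
                            (⊆ᵇ⁻ (subst T (sym X⊆Y) _)) (⊆ᵇ⁻ (subst T (sym Y⊆X) _))))
      ... | true | false = refl
      ... | false | _ = refl
      recursion : ∀ Y → μ₀ Y + sumBy (λ X → if ltᵇ X Y then μ₀ X else 0ℤ) flats ≡ (if null Y then 1ℤ else 0ℤ)
      recursion [] = cong₂ _+_ μ₀-[] (sumBy-zero-∈ flats (λ {X} _ → cong (λ b → if b then μ₀ X else 0ℤ) (∧-zeroʳ (⊆ᵇ X []))))
      recursion (y ∷ Y) = trans (cong (_+ sumBy (λ X → if ltᵇ X (y ∷ Y) then μ₀ X else 0ℤ) flats) (μ₀-∷ y Y))
                                (ℤ.+-inverseˡ (sumBy (λ X → if ltᵇ X (y ∷ Y) then μ₀ X else 0ℤ) flats))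

module PointCount (n : ℕ) (H : List (Fin n → ℤ)) where

  open import Data.Nat as ℕ using (ℕ; zero; suc; _<_; _≤_; _^_; _∸_; NonZero)
  open import Data.Integer as ℤ using (ℤ)
  open import Data.Fin using (Fin)
  open import Data.List using (List)
  open import Function using (_∘_; id)
  import Data.Nat.Properties as ℕ
  open import Data.Nat.Primality using (Prime; prime⇒nonZero)
  open import Data.Integer using (+_; 0ℤ; 1ℤ; _+_; _*_; ∣_∣)
  import Data.Integer.Properties as ℤ
  open import Data.Integer.Tactic.RingSolver using (solve-∀)
  open import Data.Integer.Divisibility.Signed using (_∣_; ∣n⇒∣m*n)
  open import Data.List using ([]; _∷_; map; length; allFin; filterᵇ; null)
  import Data.List.Properties as List
  open import Data.List.Membership.Propositional using (_∈_)
  open import Data.List.Relation.Unary.Any using (here)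
  open import Data.List.Membership.Propositional.Properties using (∈-allFin; ∈-filter⁺; ∈-filter⁻)
  import Data.List.Relation.Unary.All as All
  open import Data.Vec as Vec using (Vec)
  import Data.Vec.Properties as Vec
  open import Data.Bool using (Bool; true; false; T; not; if_then_else_)
  open import Data.Bool.ListAction using (all; any)
  open import Data.Bool.Properties using (if-float)
  open import Data.Product using (∃; _×_; _,_; proj₁; proj₂)
  open import Relation.Nullary using (¬_)
  open import Relation.Nullary.Decidable using (T?)
  open import Relation.Binary.PropositionalEquality
  open import Defs using (module Arrangement; dropAt; memb)
  open Arrangement n H
  open Sums
  open Determinant using (sign; minor)
  open Sublists
  open Booleans
  open Counting
  open Congruence
  open Rank hyp hiding (rk)
  open Möbius n H using (μ₀-sum)

  entryBound : ℕ
  entryBound = sumByℕ (λ s → sumByℕ (λ c → ∣ hyp s c ∣) (allFin n)) (allFin m)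

  ∣hyp∣≤entryBound : ∀ s c → ∣ hyp s c ∣ ≤ entryBound
  ∣hyp∣≤entryBound s c = ℕ.≤-trans (≤-sumByℕ (λ c → ∣ hyp s c ∣) (allFin n) (∈-allFin c)) (≤-sumByℕ _ (allFin m) (∈-allFin s))

  -- An r × r minor with r ≤ n is at most (entryBound · n)^r ≤ (entryBound · n + 1)^n,
  -- so no prime p ≥ minorBound divides a nonzero one.
  minorBound : ℕ
  minorBound = suc ((entryBound ℕ.* n ℕ.+ 1) ^ n)

  ∣Δ∣<minorBound : ∀ R C → length R ≡ length C → C ∈ Columns → ∣ Δ R C ∣ < minorBound
  ∣Δ∣<minorBound R C len C∈ = ℕ.s≤s (ℕ.≤-trans (Determinant.∣minor∣≤ hyp ∣hyp∣≤entryBound R C n C≤n)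
    (ℕ.≤-trans (ℕ.^-monoˡ-≤ (length R) (ℕ.m≤m+n (entryBound ℕ.* n) 1))
               (ℕ.^-monoʳ-≤ (entryBound ℕ.* n ℕ.+ 1) {{base≢0}} (subst (_≤ n) (sym len) C≤n))))
    where
    C≤n : length C ≤ n
    C≤n = ℕ.≤-trans (∈-sublists⇒length≤ (allFin n) C∈) (ℕ.≤-reflexive (List.length-tabulate id))
    base≢0 : NonZero (entryBound ℕ.* n ℕ.+ 1)
    base≢0 rewrite ℕ.+-comm (entryBound ℕ.* n) 1 = _

  bottom≡[] : (∀ s → ∃ λ c → hyp s c ≢ 0ℤ) → bottom ≡ []
  bottom≡[] nonzero = List.filter-none (T? ∘ contains []) {allFin m} (All.tabulate (λ {h} _ → not-contains h))
    where
    not-contains : ∀ h → ¬ T (contains [] h)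
    not-contains h t with nonzero h
    ... | c , hc≢0 = ℕ.n≮n 0 (begin-strict
      0                 <⟨ rank-≥ (h ∷ []) (∈-sublists-keep h [] (here refl)) ([x]∈sublists (allFin n) (∈-allFin c)) refl Δ≢0 ⟩
      rk (h ∷ [])       ≡⟨ ℕ.≡ᵇ⇒≡ _ _ t ⟩
      rk []             ≤⟨ rk≤length [] ⟩
      0                 ∎)
      where
      open ℕ.≤-Reasoning
      Δ≢0 : Δ (h ∷ []) (c ∷ []) ≢ 0ℤ
      Δ≢0 Δ≡0 = hc≢0 (trans (sym (single (hyp h c))) Δ≡0)
        where
        single : ∀ x → 1ℤ * x * 1ℤ + 0ℤ ≡ x
        single = solve-∀

  module _ (p : ℕ) (prime : Prime p) (minorBound≤p : minorBound ≤ p) (k : ℕ) where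

    instance
      p≢0 : NonZero p
      p≢0 = prime⇒nonZero prime

    open Mod p
    open Fibres p
    open Systems k n

    p∤Δ : ∀ R C → length R ≡ length C → C ∈ Columns → Δ R C ≢ 0ℤ → ¬ + p ∣ Δ R C
    p∤Δ R C len C∈ Δ≢0 p∣Δ = Δ≢0 (∣-small⇒≡0 p∣Δ (ℕ.<-≤-trans (∣Δ∣<minorBound R C len C∈) minorBound≤p))

    -- W lies on the hyperplane s: each of its k coordinate vectors does, modulo p.
    Z : Fin m → Weight → Bool
    Z s = annihilatesᵇ (hyp s)

    zeroSet : Weight → List (Fin m)
    zeroSet W = filterᵇ (λ s → Z s W) (allFin m)

    module _ {S} (mm : MaximalMinor S) where
      open MaximalMinor mm

      Z-dependent : ∀ s → (∀ c → Δ (s ∷ rows) (c ∷ cols) ≡ 0ℤ) → ∀ W → (∀ {r} → r ∈ rows → T (Z r W)) → T (Z s W)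
      Z-dependent s vanish W Z-rows = annihilatesᵇ⁺ (hyp s) W (λ j →
        ∤-cancelˡ prime (Δ rows cols) _ (p∤Δ rows cols square cols∈ nonzero)
          (∣-resp-≡ (sym (dependence-dot s rows cols square vanish (coordinate W j)))
            (∣-isum _ rows (λ i r r∈ → ∣n⇒∣m*n (sign i * Δ (s ∷ dropAt i rows) cols)
              (annihilatesᵇ⁻ (hyp r) W (Z-rows r∈) j)))))

      -- Cramer's rule over ℤ, then division by the minor modulo p.
      solvable : ∀ β → ∃ λ U → T (Solvesᵇ (map hyp rows) β U)
      solvable β = W₀ , Solvesᵇ-intro hyp rows β W₀ solves
        where
        inverse : ∃ λ e → e * Δ rows cols ≈ 1ℤ
        inverse = ∃-inverse prime (Δ rows cols) (p∤Δ rows cols square cols∈ nonzero)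
        e : ℤ
        e = proj₁ inverse
        rhs : Fin k → ℕ × Fin m → ℤ
        rhs j (i , _) = β i j
        module C (j : Fin k) = Cramer proj₂ (rhs j)
        u : Fin k → Fin n → ℤ
        u j = C.solution j (indexed rows) cols
        W₀ : Weight
        W₀ = Vec.tabulate (λ c → Vec.tabulate (λ j → reduce (e * u j c)))
        coordinate-W₀ : ∀ j c → coordinate W₀ j c ≈ e * u j c
        coordinate-W₀ j c rewrite Vec.lookup∘tabulate (λ c → Vec.tabulate (λ j → reduce (e * u j c))) c
                                | Vec.lookup∘tabulate (λ j → reduce (e * u j c)) j = reduce-≈ (e * u j c)
        solves : ∀ {i r} → (i , r) ∈ indexed rows → T (solvesᵇ (hyp r) (β i) W₀)
        solves {i} {r} ir∈ = T-all⁺ _ (allFin k) (λ {j} _ → divisibleᵇ⁺ (∣-diff (begin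
          dot (hyp r) (coordinate W₀ j)                     ≈⟨ dot-congʳ-≈ (hyp r) (coordinate-W₀ j) ⟩
          dot (hyp r) (λ c → e * u j c)                     ≡⟨ dot-*ʳ (hyp r) (u j) e ⟩
          e * dot (hyp r) (u j)                             ≡⟨ cong (e *_) (C.solution-solves j (indexed rows) cols ir∈) ⟩
          e * (β i j * Δ (map proj₂ (indexed rows)) cols)   ≡⟨ cong (λ R → e * (β i j * Δ R cols)) (map-proj₂-indexed rows) ⟩
          e * (β i j * Δ rows cols)                         ≡⟨ rearrange e (β i j) (Δ rows cols) ⟩
          β i j * (e * Δ rows cols)                         ≈⟨ *-congˡ-≈ (β i j) (proj₂ inverse) ⟩
          β i j * 1ℤ                                        ≡⟨ ℤ.*-identityʳ (β i j) ⟩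
          β i j                                             ∎)))
          where
          open ≈-Reasoning
          rearrange : ∀ e b d → e * (b * d) ≡ b * (e * d)
          rearrange = solve-∀

    memb-zeroSet : ∀ s W → memb s (zeroSet W) ≡ Z s W
    memb-zeroSet s W = T⇔⇒≡ (λ t → proj₂ (∈-filter⁻ (T? ∘ (λ s → Z s W)) {xs = allFin m} (T-memb⁻ (zeroSet W) t)))
                             (λ t → T-memb⁺ (zeroSet W) (∈-filter⁺ (T? ∘ (λ s → Z s W)) (∈-allFin s) t))

    zeroSet-closed : ∀ W → T (closedᵇ (zeroSet W))
    zeroSet-closed W = T-all⁺ _ (allFin m) (λ {h} _ → T-not-∨ (λ t → subst T (sym (memb-zeroSet h W)) (Z-h h t)))
      where
      open MaximalMinor (maximalMinor (zeroSet W))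
      Z-h : ∀ h → T (contains (zeroSet W) h) → T (Z h W)
      Z-h h t = Z-dependent (maximalMinor (zeroSet W)) h
        (border-vanishes-∷ (maximalMinor (zeroSet W)) h (ℕ.≤-reflexive (ℕ.≡ᵇ⇒≡ _ _ t))) W
        (λ r∈ → proj₂ (∈-filter⁻ (T? ∘ (λ s → Z s W)) {xs = allFin m} (∈-sublists⇒⊆ (zeroSet W) rows∈ r∈)))

    zeroSet∈flats : ∀ W → zeroSet W ∈ flats
    zeroSet∈flats W = ∈-filter⁺ (T? ∘ closedᵇ) (filterᵇ∈sublists _ (allFin m)) (zeroSet-closed W)

    kernel-count : ∀ X → sumByℕ (λ W → indicator (all (λ s → Z s W) X)) weights ≡ (p ^ k) ^ dim X
    kernel-count X = begin
      sumByℕ (λ W → indicator (all (λ s → Z s W) X)) weights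
        ≡⟨ sumByℕ-cong weights (λ W → cong indicator (on-rows W)) ⟩
      sumByℕ (indicator ∘ Annihilatesᵇ (map hyp rows)) weights
        ≡⟨ kernel-size (map hyp rows) (solvable mm ∘ target) length≤n ⟩
      (p ^ k) ^ (n ∸ length (map hyp rows))
        ≡⟨ cong (λ r → (p ^ k) ^ (n ∸ r)) (trans (List.length-map hyp rows) maximal) ⟩
      (p ^ k) ^ dim X ∎
      where
      open ≡-Reasoning
      mm : MaximalMinor X
      mm = maximalMinor X
      open MaximalMinor mm
      length≤n : length (map hyp rows) ≤ n
      length≤n = ℕ.≤-trans (ℕ.≤-reflexive (trans (List.length-map hyp rows) square))
                   (ℕ.≤-trans (∈-sublists⇒length≤ (allFin n) cols∈) (ℕ.≤-reflexive (List.length-tabulate id)))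
      on-rows : ∀ W → all (λ s → Z s W) X ≡ Annihilatesᵇ (map hyp rows) W
      on-rows W = trans (T⇔⇒≡ (λ t → T-all⁺ _ rows (λ r∈ → T-all⁻ _ X t (∈-sublists⇒⊆ X rows∈ r∈)))
                              (λ t → T-all⁺ _ X (λ s∈ → Z-dependent mm _ (border-vanishes-∈ mm s∈) W (T-all⁻ _ rows t))))
                        (sym (all-map (λ ρ → annihilatesᵇ ρ W) hyp rows))

    meetsᵇ : Weight → Bool
    meetsᵇ W = any (λ h → annihilatesᵇ h W) H

    -- Counting the pairs (X, W) with X ≤ zeroSet W in two ways: by flats through
    -- kernel-count, and by points through the Möbius identity μ₀-sum.
    charPoly-point-count : (∀ s → ∃ λ c → hyp s c ≢ 0ℤ) → charPoly (+ (p ^ k)) ≡ + length (filterᵇ (not ∘ meetsᵇ) weights)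
    charPoly-point-count nonzero = begin
      charPoly (+ (p ^ k))
        ≡⟨ sumℤ-map _ flats ⟩
      sumBy (λ X → μ₀ X * (+ (p ^ k)) ℤ.^ dim X) flats
        ≡⟨ isum-cong flats (λ _ X → by-points X) ⟩
      sumBy (λ X → sumBy (λ W → if ⊆ᵇ X (zeroSet W) then μ₀ X else 0ℤ) weights) flats
        ≡⟨ isum-swap _ flats weights ⟩
      sumBy (λ W → sumBy (λ X → if ⊆ᵇ X (zeroSet W) then μ₀ X else 0ℤ) flats) weights
        ≡⟨ isum-cong weights (λ _ W → trans (μ₀-sum (bottom≡[] nonzero) (zeroSet∈flats W)) (avoids W)) ⟩
      sumBy (λ W → + indicator (not (meetsᵇ W))) weights
        ≡⟨ pos-sumByℕ (indicator ∘ not ∘ meetsᵇ) weights ⟨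
      + sumByℕ (indicator ∘ not ∘ meetsᵇ) weights
        ≡⟨ cong +_ (length-filterᵇ (not ∘ meetsᵇ) weights) ⟨
      + length (filterᵇ (not ∘ meetsᵇ) weights) ∎
      where
      open ≡-Reasoning
      pos-^ : ∀ a b → (+ a) ℤ.^ b ≡ + (a ^ b)
      pos-^ a zero = refl
      pos-^ a (suc b) = trans (cong (+ a *_) (pos-^ a b)) (sym (ℤ.pos-* a (a ^ b)))
      pos-sumByℕ : ∀ {A : Set} (f : A → ℕ) xs → + sumByℕ f xs ≡ sumBy (λ x → + f x) xs
      pos-sumByℕ f [] = refl
      pos-sumByℕ f (x ∷ xs) = trans (ℤ.pos-+ (f x) _) (cong (_+_ (+ f x)) (pos-sumByℕ f xs))
      *-indicator : ∀ v b → v * + indicator b ≡ (if b then v else 0ℤ)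
      *-indicator v true = ℤ.*-identityʳ v
      *-indicator v false = ℤ.*-zeroʳ v
      by-points : ∀ X → μ₀ X * (+ (p ^ k)) ℤ.^ dim X ≡ sumBy (λ W → if ⊆ᵇ X (zeroSet W) then μ₀ X else 0ℤ) weights
      by-points X = begin
        μ₀ X * (+ (p ^ k)) ℤ.^ dim X
          ≡⟨ cong (μ₀ X *_) (trans (pos-^ (p ^ k) (dim X)) (cong +_ (sym (kernel-count X)))) ⟩
        μ₀ X * + sumByℕ (λ W → indicator (all (λ s → Z s W) X)) weights
          ≡⟨ cong (μ₀ X *_) (pos-sumByℕ _ weights) ⟩
        μ₀ X * sumBy (λ W → + indicator (all (λ s → Z s W) X)) weights
          ≡⟨ isum-*ˡ (μ₀ X) _ weights ⟨
        sumBy (λ W → μ₀ X * + indicator (all (λ s → Z s W) X)) weights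
          ≡⟨ isum-cong weights (λ _ W → trans (*-indicator (μ₀ X) _)
               (cong (λ b → if b then μ₀ X else 0ℤ) (sym (all-cong X (λ s → memb-zeroSet s W))))) ⟩
        sumBy (λ W → if ⊆ᵇ X (zeroSet W) then μ₀ X else 0ℤ) weights ∎
      avoids : ∀ W → (if null (zeroSet W) then 1ℤ else 0ℤ) ≡ + indicator (not (meetsᵇ W))
      avoids W = trans (cong (λ b → if b then 1ℤ else 0ℤ) (trans (null-filterᵇ _ (allFin m)) (cong not (begin
        any (λ s → Z s W) (allFin m)                ≡⟨ any-map (λ h → annihilatesᵇ h W) hyp (allFin m) ⟨
        any (λ h → annihilatesᵇ h W) (map hyp (allFin m))
          ≡⟨ cong (any (λ h → annihilatesᵇ h W)) (trans (List.map-tabulate id hyp) (List.tabulate-lookup H)) ⟩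
        meetsᵇ W                                    ∎)))) (sym (if-float +_ (not (meetsᵇ W))))

module MatchingArrangement {V n : ℕ} (ends : Fin n → Fin V × Fin V) where

  open import Data.Nat as ℕ using (ℕ; suc)
  open import Data.Fin using (Fin; toℕ)
  open import Data.Product using (_×_)
  open import Function using (_∘_)
  open import Data.Integer as ℤ using (ℤ; +_; 0ℤ; 1ℤ; -1ℤ; -_; _-_; _+_)
  import Data.Integer.Properties as ℤ
  open import Data.List using (List; []; _∷_; length; allFin; concatMap; upTo)
  open import Data.List.Membership.Propositional using (_∈_; _∉_; find)
  open import Data.List.Membership.Propositional.Properties using (∈-map⁻; ∈-lookup; ∈-filter⁻)
  open import Data.List.Relation.Unary.Any using (here; there)
  open import Data.List.Relation.Unary.Any.Properties using (any⁻)
  open import Data.Vec as Vec using (Vec)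
  open import Data.Bool using (true; false; T; not; _∧_)
  open import Data.Bool.ListAction using (any)
  open import Data.Bool.Properties using (T-∧; T-∨)
  open import Data.Product as Product using (∃; _,_; proj₁; proj₂)
  open import Data.Sum using (_⊎_; inj₁; inj₂)
  open import Data.Empty using (⊥-elim)
  open import Function.Bundles using (Equivalence)
  open import Relation.Nullary.Decidable using (T?; toWitness)
  open import Relation.Binary.PropositionalEquality
  open import Defs using (module Matching; module Arrangement; eqF; memb; distinct?; evenᵇ; listsOfLength)
  open Matching ends
  open Sums
  open Booleans

  ∧⁻ : ∀ a {b} → T (a ∧ b) → T a × T b
  ∧⁻ a = Equivalence.to (T-∧ {a})

  joins⁻ : ∀ e u w → T (joins? (ends e) u w) →
    (proj₁ (ends e) ≡ u × proj₂ (ends e) ≡ w) ⊎ (proj₁ (ends e) ≡ w × proj₂ (ends e) ≡ u)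
  joins⁻ e u w t with Equivalence.to (T-∨ {eqF (proj₁ (ends e)) u ∧ eqF (proj₂ (ends e)) w}) t
  ... | inj₁ t₁ = inj₁ (Product.map (eqF⁻ _ u) (eqF⁻ _ w) (∧⁻ (eqF (proj₁ (ends e)) u) t₁))
  ... | inj₂ t₂ = inj₂ (Product.map (eqF⁻ _ w) (eqF⁻ _ u) (∧⁻ (eqF (proj₁ (ends e)) w) t₂))

  walk-∷⁻ : ∀ e es u w vs → T (walk? (e ∷ es) (u ∷ w ∷ vs)) → T (joins? (ends e) u w) × T (walk? es (w ∷ vs))
  walk-∷⁻ e es u w vs = ∧⁻ (joins? (ends e) u w)

  distinct-∷⁻ : ∀ (x : Fin V) xs → T (distinct? (x ∷ xs)) → x ∉ xs × T (distinct? xs)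
  distinct-∷⁻ x xs t = Product.map₁ (λ x∉ x∈ → T-not⇒¬T x∉ (T-memb⁺ xs x∈)) (∧⁻ (not (memb x xs)) t)

  lastIs-∈ : ∀ {v} (l : List (Fin V)) → T (lastIs v l) → v ∈ l
  lastIs-∈ (x ∷ []) t = here (toWitness t)
  lastIs-∈ (x ∷ y ∷ l) t = there (lastIs-∈ (y ∷ l) t)

  closes-∷⁻ : ∀ v rest → T (closes? (v ∷ rest)) → T (distinct? rest) × T (lastIs v rest)
  closes-∷⁻ v rest = ∧⁻ (distinct? rest)

  endpoints-on-walk : ∀ {e} es vs → T (walk? es vs) → e ∈ es → proj₁ (ends e) ∈ vs × proj₂ (ends e) ∈ vs
  endpoints-on-walk (e ∷ es) (u ∷ w ∷ vs) t (here refl) with joins⁻ e u w (proj₁ (walk-∷⁻ e es u w vs t))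
  ... | inj₁ (a≡u , b≡w) = here a≡u , there (here b≡w)
  ... | inj₂ (a≡w , b≡u) = there (here a≡w) , here b≡u
  endpoints-on-walk (e′ ∷ es) (u ∷ w ∷ vs) t (there e∈) =
    Product.map there there (endpoints-on-walk es (w ∷ vs) (proj₂ (walk-∷⁻ e′ es u w vs t)) e∈)

  -- The first edge of a walk contains its first vertex, which the rest of the walk
  -- (containing the endpoints of its edges) avoids.
  first-edge-fresh : ∀ e es u w vs → T (walk? (e ∷ es) (u ∷ w ∷ vs)) → u ∉ w ∷ vs → e ∉ es
  first-edge-fresh e es u w vs t u∉ e∈ with walk-∷⁻ e es u w vs t
  ... | joins , walk with endpoints-on-walk es (w ∷ vs) walk e∈ | joins⁻ e u w joins
  ...   | a∈ , _ | inj₁ (refl , _) = u∉ a∈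
  ...   | _ , b∈ | inj₂ (_ , refl) = u∉ b∈

  same-edge : ∀ e {v₀ v₁ v₂} → T (joins? (ends e) v₀ v₁) → T (joins? (ends e) v₁ v₂) → v₀ ≡ v₂ ⊎ v₁ ≡ v₂
  same-edge e t₁ t₂ with joins⁻ e _ _ t₁ | joins⁻ e _ _ t₂
  ... | inj₁ (refl , refl) | inj₁ (_ , refl) = inj₂ refl
  ... | inj₁ (refl , refl) | inj₂ (refl , _) = inj₁ refl
  ... | inj₂ (refl , refl) | inj₁ (_ , refl) = inj₁ refl
  ... | inj₂ (refl , refl) | inj₂ (refl , _) = inj₂ refl

  altVec-∉ : ∀ {i} es → i ∉ es → altVec es i ≡ 0ℤ
  altVec-∉ [] _ = refl
  altVec-∉ {i} (e ∷ es) i∉ with eqF e i in eq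
  ... | true = ⊥-elim (i∉ (here (sym (toWitness (subst T (sym eq) _)))))
  ... | false = trans (ℤ.+-identityˡ _) (cong -_ (altVec-∉ es (i∉ ∘ there)))

  altVec-first : ∀ {i} es → i ∉ es → altVec (i ∷ es) i ≡ 1ℤ
  altVec-first {i} es i∉ rewrite eqF-refl i | altVec-∉ es i∉ = refl

  altVec-second : ∀ {e₁ e₂} es → e₁ ≢ e₂ → e₂ ∉ es → altVec (e₁ ∷ e₂ ∷ es) e₂ ≡ -1ℤ
  altVec-second {e₂ = e₂} es e₁≢e₂ e₂∉ rewrite eqF-≢ e₁≢e₂ | eqF-refl e₂ | altVec-∉ es e₂∉ = refl

  path-first-edge : ∀ {e es} vs → T (distinct? vs) → T (walk? (e ∷ es) vs) → e ∉ es
  path-first-edge {e} {es} (u ∷ w ∷ vs) d wk = first-edge-fresh e es u w vs wk (proj₁ (distinct-∷⁻ u (w ∷ vs) d))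

  -- The first vertex of a cycle recurs at its end, so argue with the second edge,
  -- whose first vertex does not recur.
  cycle-second-edge : ∀ {e₁ e₂ e₃ es} vs → T (closes? vs) → T (walk? (e₁ ∷ e₂ ∷ e₃ ∷ es) vs) →
    e₁ ≢ e₂ × e₂ ∉ e₃ ∷ es
  cycle-second-edge {e₁} {e₂} {e₃} {es} (v₀ ∷ v₁ ∷ v₂ ∷ v₃ ∷ vs) cl wk
    with closes-∷⁻ v₀ (v₁ ∷ v₂ ∷ v₃ ∷ vs) cl | walk-∷⁻ e₁ (e₂ ∷ e₃ ∷ es) v₀ v₁ (v₂ ∷ v₃ ∷ vs) wk
  ... | distinct , last | joins₁ , walk₂
    with distinct-∷⁻ v₁ (v₂ ∷ v₃ ∷ vs) distinct | walk-∷⁻ e₂ (e₃ ∷ es) v₁ v₂ (v₃ ∷ vs) walk₂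
  ... | v₁∉ , distinct₂ | joins₂ , _ = e₁≢e₂ , first-edge-fresh e₂ (e₃ ∷ es) v₁ v₂ (v₃ ∷ vs) walk₂ v₁∉
    where
    v₂∉ : v₂ ∉ v₃ ∷ vs
    v₂∉ = proj₁ (distinct-∷⁻ v₂ (v₃ ∷ vs) distinct₂)
    e₁≢e₂ : e₁ ≢ e₂
    e₁≢e₂ refl with same-edge e₁ joins₁ joins₂
    ... | inj₁ v₀≡v₂ = v₂∉ (subst (_∈ v₃ ∷ vs) v₀≡v₂ (lastIs-∈ (v₃ ∷ vs) last))
    ... | inj₂ v₁≡v₂ = v₁∉ (here v₁≡v₂)
  cycle-second-edge {e₁} {e₂} {e₃} {es} (v₀ ∷ v₁ ∷ []) _ wk
    with () ← proj₂ (walk-∷⁻ e₁ (e₂ ∷ e₃ ∷ es) v₀ v₁ [] wk)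
  cycle-second-edge {e₁} {e₂} {e₃} {es} (v₀ ∷ v₁ ∷ v₂ ∷ []) _ wk
    with () ← proj₂ (walk-∷⁻ e₂ (e₃ ∷ es) v₁ v₂ [] (proj₂ (walk-∷⁻ e₁ (e₂ ∷ e₃ ∷ es) v₀ v₁ (v₂ ∷ []) wk)))

  simplePath⁻ : ∀ es → T (simplePath? es) → ∃ λ vs → T (distinct? vs) × T (walk? es vs)
  simplePath⁻ (e ∷ es) t
    with find (any⁻ (λ vs → distinct? vs ∧ walk? (e ∷ es) vs) (listsOfLength (suc (length (e ∷ es))) (allFin V)) t)
  ... | vs , _ , dw = vs , ∧⁻ (distinct? vs) dw

  evenCycle⁻ : ∀ es → T (evenCycle? es) → ∃ λ vs → T (closes? vs) × T (walk? es vs)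
  evenCycle⁻ es t with find (any⁻ (λ vs → closes? vs ∧ walk? es vs) (listsOfLength (suc (length es)) (allFin V))
                          (proj₂ (∧⁻ (3 ℕ.≤ᵇ length es) (proj₂ (∧⁻ (evenᵇ (length es)) t)))))
  ... | vs , _ , cw = vs , ∧⁻ (closes? vs) cw

  valid-normal : ∀ es → T (valid? es) → ∃ λ c → altVec es c ≢ 0ℤ
  valid-normal es t with Equivalence.to (T-∨ {simplePath? es}) t
  valid-normal (e ∷ es) _ | inj₁ path with simplePath⁻ (e ∷ es) path
  ... | vs , distinct , walk = e , λ z → 1≢0 (trans (sym (altVec-first es (path-first-edge vs distinct walk))) z)
    where
    1≢0 : 1ℤ ≢ 0ℤ
    1≢0 ()
  valid-normal (e₁ ∷ e₂ ∷ e₃ ∷ es) _ | inj₂ cycle with evenCycle⁻ (e₁ ∷ e₂ ∷ e₃ ∷ es) cycle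
  ... | vs , closed , walk with cycle-second-edge vs closed walk
  ... | e₁≢e₂ , e₂∉ = e₂ , λ z → -1≢0 (trans (sym (altVec-second (e₃ ∷ es) e₁≢e₂ e₂∉)) z)
    where
    -1≢0 : -1ℤ ≢ 0ℤ
    -1≢0 ()

  MA-nonzero : ∀ s → ∃ λ c → Arrangement.hyp n MA s c ≢ 0ℤ
  MA-nonzero s with ∈-map⁻ altVec (∈-lookup {xs = MA} s)
  ... | es , es∈ , hyp≡ rewrite hyp≡ = valid-normal es (proj₂ (∈-filter⁻ (T? ∘ valid?) {xs = candidates} es∈))
    where
    candidates : List (List (Fin n))
    candidates = concatMap (λ ℓ → listsOfLength ℓ (allFin n)) (upTo (suc n))

  altW≡dot : ∀ {p k} (W : Weight p k) es j → altW W es j ≡ dot (altVec es) (λ c → + toℕ (Vec.lookup (Vec.lookup W c) j))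
  altW≡dot W [] j = sym (dot-zeroˡ (λ c → + toℕ (Vec.lookup (Vec.lookup W c) j)))
  altW≡dot W (i ∷ is) j = sym (begin
    dot (λ c → δ i c - altVec is c) w         ≡⟨ dot-comm _ w ⟩
    dot w (λ c → δ i c - altVec is c)         ≡⟨ dot-+ʳ w (δ i) (λ c → - altVec is c) ⟩
    dot w (δ i) + dot w (λ c → - altVec is c) ≡⟨ cong₂ _+_ (dot-δʳ w i) (dot-negʳ w (altVec is)) ⟩
    w i - dot w (altVec is)                   ≡⟨ cong (λ x → w i - x) (trans (dot-comm w (altVec is)) (sym (altW≡dot W is j))) ⟩
    altW W (i ∷ is) j                         ∎)
    where
    open ≡-Reasoning
    w : Fin n → ℤ
    w c = + toℕ (Vec.lookup (Vec.lookup W c) j)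

  module _ (p : ℕ) .{{_ : ℕ.NonZero p}} (k : ℕ) where
    open Fibres p
    open Systems k n

    improper≡meets : ∀ W → improper? W ≡ any (λ h → annihilatesᵇ h W) MA
    improper≡meets W = sym (trans (any-map (λ h → annihilatesᵇ h W) altVec validSeqs)
      (any-cong validSeqs (λ es → all-cong (allFin k) (λ j → cong divisibleᵇ (sym (altW≡dot W es j))))))

mainTheorem4 : ∀ (V n : ℕ) (ends : Fin n → Fin V × Fin V) → SimpleGraph ends →
    ∃[ N ] (∀ (p : ℕ) → Prime p → N ≤ p → ∀ (k : ℕ) → 1 ≤ k →
    Matching.χMA ends (+ (p ^ k)) ≡ + Matching.numProper ends p k)
mainTheorem4 V n ends _ = minorBound , λ p prime N≤p k _ →
  let instance _ = prime⇒nonZero prime in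
  trans (charPoly-point-count p prime N≤p k MA-nonzero)
        (cong (λ l → + length l) (filterᵇ-cong (allVecs n (allVecs k (allFin p)))
          (λ W → cong not (sym (improper≡meets p k W)))))
  where
  open Matching ends
  open PointCount n MA
  open MatchingArrangement ends
  open Booleans using (filterᵇ-cong)
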